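{- Let $\psi$ be an integral polymatroid rank function on $2^{[n]}$ and let $\mathcal{C}$ be the tangent cone of a vertex $\mathbf{v}$ of the polymatroid $\mathcal{P}(\psi)$, translated to the origin. Then $\mathcal{C}$ is generated by extremal ray generators $\{\mathbf{r}_1,\dots,\mathbf{r}_l\}\subseteq R_{\operatorname{supp}(\mathbf{v})}$.
   Context: A polymatroid rank function $\psi$ on $2^{[n]}$ is submodular, non-decreasing, and satisfies $\psi(\emptyset)=0$; integral if integer-valued. $\mathcal{P}(\psi)=\{\mathbf{x}\in\mathbb{R}^n:\sum_{i\in A}x_i\le\psi(A)\ \forall A\subseteq[n],\ \mathbf{x}\ge\mathbf{0}\}$. The tangent cone of a vertex $\mathbf{v}$ of a polytope $\mathcal{P}$ is $\{\mathbf{v}+\mathbf{w}:\mathbf{v}+\epsilon\mathbf{w}\in\mathcal{P}\text{ for some }\epsilon>0\}$; translated to the origin it is $\{\mathbf{w}:\mathbf{v}+\epsilon\mathbf{w}\in\mathcal{P}\text{ for some }\epsilon>0\}$. $\operatorname{supp}(\mathbf{v})=\{i:v_i\ne0\}$. For $A\subseteq[n]$, $R_A=\{\mathbf{e}_i-\mathbf{e}_j,\ \mathbf{e}_i,\ -\mathbf{e}_j: i\in[n],\ j\in A\}$.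
   Formalization: The polymatroid $\mathcal{P}(\psi)$, its vertices, the tangent cone and its ray generators are taken over ℚ^n rather than ℝ^n, with rational ε, combination coefficients and decompositions. -}

module Defs where

open import Data.Nat using (ℕ; zero; suc)
open import Data.Integer using (ℤ)
open import Data.Rational using (ℚ; 0ℚ; 1ℚ; _+_; _*_; -_; _-_; _≤_; _<_; _/_)
open import Data.Rational.Properties using (_≟_)
import Data.Integer.Properties as ℤP
import Data.Fin.Properties as FinP
open import Data.Fin using (Fin; zero; suc)
open import Data.Fin.Subset using (Subset; _∈_; _⊆_; _∪_; _∩_; ⊥; inside; outside)
open import Data.Vec using (lookup; tabulate)
open import Data.Bool using (Bool; true; false; if_then_else_; not)
open import Data.Product using (Σ; _×_; _,_; ∃)
open import Data.Sum using (_⊎_)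
open import Relation.Nullary using (¬_)
open import Relation.Nullary.Decidable using (⌊_⌋)
open import Relation.Binary.PropositionalEquality using (_≡_)

Vecℚ : ℕ → Set
Vecℚ n = Fin n → ℚ

sumFin : ∀ {n} → (Fin n → ℚ) → ℚ
sumFin {zero}  f = 0ℚ
sumFin {suc n} f = f zero + sumFin {n} (λ i → f (suc i))

sumOver : ∀ {n} → Subset n → Vecℚ n → ℚ
sumOver A x = sumFin (λ i → if lookup A i then x i else 0ℚ)

_⊕_ : ∀ {n} → Vecℚ n → Vecℚ n → Vecℚ n
(x ⊕ y) i = x i + y i

_⊙_ : ∀ {n} → ℚ → Vecℚ n → Vecℚ n
(c ⊙ x) i = c * x i

⊖_ : ∀ {n} → Vecℚ n → Vecℚ n
(⊖ x) i = - x i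

𝟎 : ∀ {n} → Vecℚ n
𝟎 i = 0ℚ

_≐_ : ∀ {n} → Vecℚ n → Vecℚ n → Set
x ≐ y = ∀ i → x i ≡ y i

e : ∀ {n} → Fin n → Vecℚ n
e i k = if ⌊ i FinP.≟ k ⌋ then 1ℚ else 0ℚ

toℚ : ℤ → ℚ
toℚ z = z / 1

record IsIntegralPolymatroid {n : ℕ} (ψ : Subset n → ℤ) : Set where
  field
    empty        : ψ ⊥ ≡ Data.Integer.+ 0
    nondecreasing : ∀ A B → A ⊆ B → ψ A Data.Integer.≤ ψ B
    submodular   : ∀ A B → (ψ (A ∪ B) Data.Integer.+ ψ (A ∩ B)) Data.Integer.≤ (ψ A Data.Integer.+ ψ B)

Polymatroid : ∀ {n} → (Subset n → ℤ) → Vecℚ n → Set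
Polymatroid ψ x = (∀ A → sumOver A x ≤ toℚ (ψ A)) × (∀ i → 0ℚ ≤ x i)

IsVertex : ∀ {n} → (Vecℚ n → Set) → Vecℚ n → Set
IsVertex {n} P v = P v × (∀ (y z : Vecℚ n) (t : ℚ) → P y → P z → 0ℚ < t → t < 1ℚ →
                     v ≐ ((t ⊙ y) ⊕ ((1ℚ - t) ⊙ z)) → y ≐ v × z ≐ v)

TangentCone : ∀ {n} → (Vecℚ n → Set) → Vecℚ n → Vecℚ n → Set
TangentCone P v w = Σ ℚ λ ε → 0ℚ < ε × P (v ⊕ (ε ⊙ w))

supp : ∀ {n} → Vecℚ n → Subset n
supp v = tabulate (λ i → not ⌊ v i ≟ 0ℚ ⌋)

InR : ∀ {n} → Subset n → Vecℚ n → Set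
InR {n} A r =
    (Σ (Fin n) λ i → Σ (Fin n) λ j → j ∈ A × r ≐ (e i ⊕ (⊖ e j)))
  ⊎ (Σ (Fin n) λ i → r ≐ e i)
  ⊎ (Σ (Fin n) λ j → j ∈ A × r ≐ (⊖ e j))

conicComb : ∀ {n l} → (Fin l → ℚ) → (Fin l → Vecℚ n) → Vecℚ n
conicComb λs r i = sumFin (λ k → λs k * r k i)

GeneratedBy : ∀ {n l} → (Vecℚ n → Set) → (Fin l → Vecℚ n) → Set
GeneratedBy {n} {l} C r =
  ∀ (w : Vecℚ n) → (C w → Σ (Fin l → ℚ) λ λs → (∀ k → 0ℚ ≤ λs k) × w ≐ conicComb λs r)
                 × (Σ (Fin l → ℚ) λ λs → (∀ k → 0ℚ ≤ λs k) × w ≐ conicComb λs r → C w)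

IsExtremalRayGenerator : ∀ {n} → (Vecℚ n → Set) → Vecℚ n → Set
IsExtremalRayGenerator {n} C r =
  C r × ¬ (r ≐ 𝟎) ×
  (∀ (a b : Vecℚ n) → C a → C b → r ≐ (a ⊕ b) →
     (Σ ℚ λ s → 0ℚ ≤ s × a ≐ (s ⊙ r)) × (Σ ℚ λ s → 0ℚ ≤ s × b ≐ (s ⊙ r)))

-- The tangent cone of 𝒫(ψ) at v is cut out by the constraints tight at v: w(A) ≤ 0 for
-- every tight set A (v(A) = ψ(A)) and w_i ≥ 0 for i ∉ supp v. By submodularity the tight
-- sets are closed under ∪ and ∩, and the cone is pointed because v is a vertex. Write
-- i ↝ j when j ∈ supp v and every tight set containing i contains j. The extreme rays are
-- e_i for i in no tight set, −e_j for ↝-minimal j, and e_i − e_j for i ↝ j with i in a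
-- tight set and nothing strictly ↝-between them. A feasible w with a positive entry w_i
-- loses that entry, or its sum over some tight set, when a suitable multiple of e_i or of
-- some e_i − e_j is subtracted, so induction on the number of nonzero entries and tight
-- sums writes w as a nonnegative combination of rays; a w ≤ 0 is a combination of the
-- −e_j. Each ray has a weight vector positive on it and nonpositive on all other rays,
-- which together with pointedness makes it extremal.

module Submission where

open import Defs
open import Algebra.Bundles using (CommutativeRing)
open import Data.Bool.Base using (Bool; true; false; if_then_else_; not; _∧_; _∨_)
open import Data.Fin.Base using (Fin; zero; suc)
import Data.Fin.Properties as Fin
open import Data.Fin.Subset using (Subset; _∈_; _∉_; _⊆_; _∪_; _∩_; ⊥; ⋃; ⋂; inside; outside)
open import Data.Fin.Subset.Properties
  using (_∈?_; anySubset?; ∉⊥; x∈p∪q⁻; x∈p∩q⁺; p⊆p∪q; q⊆p∪q; p∩q⊆p; p∩q⊆q; ∩-identityʳ)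
open import Data.Integer.Base as ℤ using (ℤ)
import Data.Integer.Properties as ℤ
open import Data.List.Base using (List; []; _∷_; map; _++_; filter; length; allFin; cartesianProductWith)
import Data.List.Base as List
import Data.List.Extrema
open import Data.List.Membership.Propositional using () renaming (_∈_ to _∈ₗ_)
open import Data.List.Membership.Propositional.Properties
  using (∈-allFin; ∈-filter⁺; ∈-filter⁻; ∈-lookup; ∈-map⁺; ∈-map⁻; ∈-++⁺ˡ; ∈-++⁺ʳ; ∈-cartesianProductWith⁺)
open import Data.List.Relation.Unary.All using (All; []; _∷_)
import Data.List.Relation.Unary.All as All
open import Data.List.Relation.Unary.All.Properties using (all-filter)
import Data.List.Relation.Unary.All.Properties as All
open import Data.List.Relation.Unary.Any using (index; here; there)
open import Data.List.Relation.Unary.Any.Properties using (lookup-index)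
open import Data.Nat.Base as ℕ using (ℕ; zero; suc; z≤n; s≤s)
import Data.Nat.Coprimality as Coprime
import Data.Nat.Induction as ℕ
import Data.Nat.Properties as ℕ
open import Data.Product.Base using (Σ; _×_; _,_; proj₁; proj₂)
open import Data.Rational.Base hiding (floor; ceiling; truncate)
open import Data.Rational.Properties
open import Data.Rational.Solver using (module +-*-Solver)
open import Data.Sum.Base using (_⊎_; inj₁; inj₂; [_,_]′)
import Data.Sum.Base as Sum
open import Data.Vec.Base using ([]; _∷_; lookup)
open import Data.Vec.Properties using ([]=⇒lookup; lookup⇒[]=; lookup-zipWith; lookup∘tabulate)
open import Function.Base using (_∘_; id)
import Induction.WellFounded as WF
open import Level using (0ℓ)
open import Relation.Binary.Bundles using (DecTotalOrder)
import Relation.Binary.Construct.On as On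
open import Relation.Binary.PropositionalEquality
open import Relation.Nullary using (¬_; Dec; yes; no; ¬?; _×-dec_; _⊎-dec_; _→-dec_)
open import Relation.Nullary.Decidable using (⌊_⌋; isYes≗does; dec-true; dec-false; decidable-stable)
open import Relation.Nullary.Negation using (contradiction)

open import Algebra.Properties.Semiring.Sum (CommutativeRing.semiring +-*-commutativeRing)
  using (sum; ∑-distrib-+; *-distribˡ-sum; sum-replicate-zero)
open +-*-Solver using (solve; _:+_; _:*_; :-_; _:-_; _:=_; con)
module Extrema = Data.List.Extrema (DecTotalOrder.totalOrder ≤-decTotalOrder)

private
  variable
    n : ℕ

0≤1 : 0ℚ ≤ 1ℚ
0≤1 = <⇒≤ (positive⁻¹ 1ℚ)

p≤q⇒0≤q-p : ∀ {p q} → p ≤ q → 0ℚ ≤ q - p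
p≤q⇒0≤q-p {p} {q} p≤q = subst (_≤ q - p) (+-inverseʳ p) (+-monoˡ-≤ (- p) p≤q)

0≤q-p⇒p≤q : ∀ {p q} → 0ℚ ≤ q - p → p ≤ q
0≤q-p⇒p≤q {p} {q} 0≤q-p = subst₂ _≤_ (+-identityˡ p) (solve 2 (λ p q → q :- p :+ p := q) refl p q) (+-monoˡ-≤ p 0≤q-p)

p≤q⇒p-q≤0 : ∀ {p q} → p ≤ q → p - q ≤ 0ℚ
p≤q⇒p-q≤0 {p} {q} p≤q = subst (p - q ≤_) (+-inverseʳ q) (+-monoˡ-≤ (- q) p≤q)

0<q-p⇒p<q : ∀ {p q} → 0ℚ < q - p → p < q
0<q-p⇒p<q {p} {q} 0<q-p = subst₂ _<_ (+-identityˡ p) (solve 2 (λ p q → q :- p :+ p := q) refl p q) (+-monoˡ-< p 0<q-p)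

≤∧≢⇒< : ∀ {p q} → p ≤ q → p ≢ q → p < q
≤∧≢⇒< {p} {q} p≤q p≢q with p <? q
... | yes p<q = p<q
... | no p≮q = contradiction (≤-antisym p≤q (≮⇒≥ p≮q)) p≢q

<⇒≱ : ∀ {p q} → p < q → ¬ (q ≤ p)
<⇒≱ p<q q≤p = <-irrefl refl (<-≤-trans p<q q≤p)

neg-involutive : ∀ p → - (- p) ≡ p
neg-involutive p = solve 1 (λ p → :- (:- p) := p) refl p

nonNeg*nonNeg : ∀ {p q} → 0ℚ ≤ p → 0ℚ ≤ q → 0ℚ ≤ p * q
nonNeg*nonNeg {p} {q} 0≤p 0≤q =
  nonNegative⁻¹ _ {{nonNeg*nonNeg⇒nonNeg p {{nonNegative 0≤p}} q {{nonNegative 0≤q}}}}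

nonNeg*nonPos : ∀ {p q} → 0ℚ ≤ p → q ≤ 0ℚ → p * q ≤ 0ℚ
nonNeg*nonPos {p} {q} 0≤p q≤0 =
  nonPositive⁻¹ _ {{nonNeg*nonPos⇒nonPos p {{nonNegative 0≤p}} q {{nonPositive q≤0}}}}

pos*p≡0⇒p≡0 : ∀ {t p} → 0ℚ < t → t * p ≡ 0ℚ → p ≡ 0ℚ
pos*p≡0⇒p≡0 {t} {p} 0<t tp≡0 = ≤-antisym
  (*-cancelˡ-≤-pos t {{positive 0<t}} (≤-reflexive (trans tp≡0 (sym (*-zeroʳ t)))))
  (*-cancelˡ-≤-pos t {{positive 0<t}} (≤-reflexive (trans (*-zeroʳ t) (sym tp≡0))))

pos⊓pos : ∀ {p q} → 0ℚ < p → 0ℚ < q → 0ℚ < p ⊓ q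
pos⊓pos {p} {q} 0<p 0<q with ⊓-sel p q
... | inj₁ ≡p = subst (0ℚ <_) (sym ≡p) 0<p
... | inj₂ ≡q = subst (0ℚ <_) (sym ≡q) 0<q

+-squeeze : ∀ {a b c d} → a ≤ b → c ≤ d → b + d ≤ a + c → a ≡ b × c ≡ d
+-squeeze {a} {b} {c} {d} a≤b c≤d b+d≤a+c =
  ≤-antisym a≤b (0≤q-p⇒p≤q (subst (0ℚ ≤_)
    (solve 4 (λ a b c d → (a :+ c) :- (b :+ d) :+ (d :- c) := a :- b) refl a b c d) gap+slack-cd)) ,
  ≤-antisym c≤d (0≤q-p⇒p≤q (subst (0ℚ ≤_)
    (solve 4 (λ a b c d → (a :+ c) :- (b :+ d) :+ (b :- a) := c :- d) refl a b c d) gap+slack-ab))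
  where
  gap+slack-cd : 0ℚ ≤ (a + c) - (b + d) + (d - c)
  gap+slack-cd = +-mono-≤ (p≤q⇒0≤q-p b+d≤a+c) (p≤q⇒0≤q-p c≤d)
  gap+slack-ab : 0ℚ ≤ (a + c) - (b + d) + (b - a)
  gap+slack-ab = +-mono-≤ (p≤q⇒0≤q-p b+d≤a+c) (p≤q⇒0≤q-p a≤b)

x≡u*x+y⇒1≤u : ∀ {x u y} → 0ℚ < x → y ≤ 0ℚ → x ≡ u * x + y → 1ℚ ≤ u
x≡u*x+y⇒1≤u {x} {u} {y} 0<x y≤0 x≡ = 0≤q-p⇒p≤q (subst (0ℚ ≤_) (solve 1 (λ u → :- (con 1ℚ :- u) := u :- con 1ℚ) refl u)
  (neg-antimono-≤ (*-cancelˡ-≤-pos x {{positive 0<x}} (subst₂ _≤_ (sym x[1-u]≡y) (sym (*-zeroʳ x)) y≤0))))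
  where
  x[1-u]≡y : x * (1ℚ - u) ≡ y
  x[1-u]≡y = trans (solve 2 (λ x u → x :* (con 1ℚ :- u) := x :- u :* x) refl x u)
    (trans (cong (_- u * x) x≡) (solve 3 (λ x u y → u :* x :+ y :- u :* x := y) refl x u y))

toℚ≡mkℚ : ∀ z → toℚ z ≡ mkℚ z 0 (Coprime.sym (Coprime.1-coprimeTo ℤ.∣ z ∣))
toℚ≡mkℚ z = ↥p/↧p≡p (mkℚ z 0 (Coprime.sym (Coprime.1-coprimeTo ℤ.∣ z ∣)))

toℚ-+ : ∀ a b → toℚ (a ℤ.+ b) ≡ toℚ a + toℚ b
toℚ-+ a b rewrite toℚ≡mkℚ a | toℚ≡mkℚ b | ℤ.*-identityʳ a | ℤ.*-identityʳ b = refl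

toℚ-mono : ∀ {a b} → a ℤ.≤ b → toℚ a ≤ toℚ b
toℚ-mono {a} {b} a≤b rewrite toℚ≡mkℚ a | toℚ≡mkℚ b =
  *≤* (subst₂ ℤ._≤_ (sym (ℤ.*-identityʳ a)) (sym (ℤ.*-identityʳ b)) a≤b)

sumFin≡sum : (f : Fin n → ℚ) → sumFin f ≡ sum f
sumFin≡sum {zero} f = refl
sumFin≡sum {suc n} f = cong (f zero +_) (sumFin≡sum (λ i → f (suc i)))

sumFin-cong : {f g : Fin n → ℚ} → (∀ i → f i ≡ g i) → sumFin f ≡ sumFin g
sumFin-cong {zero} f≗g = refl
sumFin-cong {suc n} f≗g = cong₂ _+_ (f≗g zero) (sumFin-cong (λ i → f≗g (suc i)))

sumFin-+ : (f g : Fin n → ℚ) → sumFin (λ i → f i + g i) ≡ sumFin f + sumFin g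
sumFin-+ f g rewrite sumFin≡sum (λ i → f i + g i) | sumFin≡sum f | sumFin≡sum g = ∑-distrib-+ f g

sumFin-*ˡ : ∀ c (f : Fin n → ℚ) → sumFin (λ i → c * f i) ≡ c * sumFin f
sumFin-*ˡ c f rewrite sumFin≡sum (λ i → c * f i) | sumFin≡sum f = sym (*-distribˡ-sum c f)

sumFin-zero : ∀ n → sumFin {n} (λ _ → 0ℚ) ≡ 0ℚ
sumFin-zero n = trans (sumFin≡sum {n} _) (sum-replicate-zero n)

sumFin-single : ∀ (f : Fin n → ℚ) i → (∀ j → j ≢ i → f j ≡ 0ℚ) → sumFin f ≡ f i
sumFin-single {suc n} f zero f≡0 = begin
  f zero + sumFin (λ j → f (suc j)) ≡⟨ cong (f zero +_) (trans (sumFin-cong (λ j → f≡0 (suc j) (λ ()))) (sumFin-zero n)) ⟩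
  f zero + 0ℚ                       ≡⟨ +-identityʳ (f zero) ⟩
  f zero                            ∎
  where open ≡-Reasoning
sumFin-single f (suc i) f≡0 = begin
  f zero + sumFin (λ j → f (suc j)) ≡⟨ cong₂ _+_ (f≡0 zero (λ ()))
                                         (sumFin-single _ i (λ j j≢i → f≡0 (suc j) (j≢i ∘ Fin.suc-injective))) ⟩
  0ℚ + f (suc i)                    ≡⟨ +-identityˡ (f (suc i)) ⟩
  f (suc i)                         ∎
  where open ≡-Reasoning

sumFin-nonNeg : {f : Fin n → ℚ} → (∀ i → 0ℚ ≤ f i) → 0ℚ ≤ sumFin f
sumFin-nonNeg {zero} 0≤f = ≤-refl
sumFin-nonNeg {suc n} 0≤f = +-mono-≤ (0≤f zero) (sumFin-nonNeg (λ i → 0≤f (suc i)))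

sumFin-≥-single : ∀ (f : Fin n → ℚ) i → (∀ j → j ≢ i → 0ℚ ≤ f j) → f i ≤ sumFin f
sumFin-≥-single f zero 0≤f = subst (_≤ sumFin f) (+-identityʳ (f zero))
  (+-monoʳ-≤ (f zero) (sumFin-nonNeg (λ j → 0≤f (suc j) (λ ()))))
sumFin-≥-single f (suc i) 0≤f = subst (_≤ sumFin f) (+-identityˡ (f (suc i)))
  (+-mono-≤ (0≤f zero (λ ())) (sumFin-≥-single (λ j → f (suc j)) i (λ j j≢i → 0≤f (suc j) (j≢i ∘ Fin.suc-injective))))

𝟙 : (Fin n → Bool) → Vecℚ n
𝟙 b i = if b i then 1ℚ else 0ℚ

𝟙-true : ∀ (b : Fin n → Bool) {i} → b i ≡ true → 𝟙 b i ≡ 1ℚ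
𝟙-true b bi≡true rewrite bi≡true = refl

𝟙-false : ∀ (b : Fin n → Bool) {i} → b i ≡ false → 𝟙 b i ≡ 0ℚ
𝟙-false b bi≡false rewrite bi≡false = refl

𝟙-nonNeg : ∀ (b : Fin n → Bool) i → 0ℚ ≤ 𝟙 b i
𝟙-nonNeg b i with b i
... | true = 0≤1
... | false = ≤-refl

𝟙-mono : ∀ (b : Fin n → Bool) i j → (b i ≡ true → b j ≡ true) → 𝟙 b i ≤ 𝟙 b j
𝟙-mono b i j bi⇒bj with b i
... | true rewrite bi⇒bj refl = ≤-refl
... | false = 𝟙-nonNeg b j

isYes-true : ∀ {A : Set} (a? : Dec A) → A → ⌊ a? ⌋ ≡ true
isYes-true a? a = trans (isYes≗does a?) (dec-true a? a)

isYes-false : ∀ {A : Set} (a? : Dec A) → ¬ A → ⌊ a? ⌋ ≡ false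
isYes-false a? ¬a = trans (isYes≗does a?) (dec-false a? ¬a)

𝟙? : {P : Fin n → Set} → (∀ x → Dec (P x)) → Vecℚ n
𝟙? P? = 𝟙 (λ x → ⌊ P? x ⌋)

𝟙?-yes : ∀ {P : Fin n → Set} (P? : ∀ x → Dec (P x)) {x} → P x → 𝟙? P? x ≡ 1ℚ
𝟙?-yes P? {x} Px = 𝟙-true (λ y → ⌊ P? y ⌋) (isYes-true (P? x) Px)

𝟙?-no : ∀ {P : Fin n → Set} (P? : ∀ x → Dec (P x)) {x} → ¬ P x → 𝟙? P? x ≡ 0ℚ
𝟙?-no P? {x} ¬Px = 𝟙-false (λ y → ⌊ P? y ⌋) (isYes-false (P? x) ¬Px)

𝟙?-nonNeg : ∀ {P : Fin n → Set} (P? : ∀ x → Dec (P x)) x → 0ℚ ≤ 𝟙? P? x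
𝟙?-nonNeg P? = 𝟙-nonNeg (λ y → ⌊ P? y ⌋)

𝟙?-mono : ∀ {P : Fin n → Set} (P? : ∀ x → Dec (P x)) {x y} → (P x → P y) → 𝟙? P? x ≤ 𝟙? P? y
𝟙?-mono P? {x} {y} Px⇒Py with P? x
... | yes Px = ≤-reflexive (sym (𝟙?-yes P? (Px⇒Py Px)))
... | no _ = 𝟙-nonNeg (λ z → ⌊ P? z ⌋) y

e-diag : ∀ (i : Fin n) → e i i ≡ 1ℚ
e-diag i = 𝟙?-yes (i Fin.≟_) refl

e-off : ∀ {i k : Fin n} → i ≢ k → e i k ≡ 0ℚ
e-off {i = i} i≢k = 𝟙?-no (i Fin.≟_) i≢k

e-nonNeg : ∀ (i k : Fin n) → 0ℚ ≤ e i k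
e-nonNeg i = 𝟙?-nonNeg (i Fin.≟_)

infix 8 _·_

_·_ : Vecℚ n → Vecℚ n → ℚ
c · x = sumFin (λ i → c i * x i)

·-congˡ : ∀ {c d : Vecℚ n} x → c ≐ d → c · x ≡ d · x
·-congˡ x c≐d = sumFin-cong (λ i → cong (_* x i) (c≐d i))

·-congʳ : ∀ (c : Vecℚ n) {x y} → x ≐ y → c · x ≡ c · y
·-congʳ c x≐y = sumFin-cong (λ i → cong (c i *_) (x≐y i))

·-comm : ∀ (c x : Vecℚ n) → c · x ≡ x · c
·-comm c x = sumFin-cong (λ i → *-comm (c i) (x i))

·-⊕ʳ : ∀ (c x y : Vecℚ n) → c · (x ⊕ y) ≡ c · x + c · y
·-⊕ʳ c x y = trans (sumFin-cong (λ i → *-distribˡ-+ (c i) (x i) (y i))) (sumFin-+ (λ i → c i * x i) (λ i → c i * y i))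

·-⊕ˡ : ∀ (c d x : Vecℚ n) → (c ⊕ d) · x ≡ c · x + d · x
·-⊕ˡ c d x = trans (sumFin-cong (λ i → *-distribʳ-+ (x i) (c i) (d i))) (sumFin-+ (λ i → c i * x i) (λ i → d i * x i))

·-⊙ : ∀ (c : Vecℚ n) t x → c · (t ⊙ x) ≡ t * (c · x)
·-⊙ c t x = trans (sumFin-cong (λ i → solve 3 (λ c t x → c :* (t :* x) := t :* (c :* x)) refl (c i) t (x i)))
                  (sumFin-*ˡ t (λ i → c i * x i))

·-⊙ˡ : ∀ t (c x : Vecℚ n) → (t ⊙ c) · x ≡ t * (c · x)
·-⊙ˡ t c x = trans (·-comm (t ⊙ c) x) (trans (·-⊙ x t c) (cong (t *_) (·-comm x c)))

·-⊖ : ∀ (c x : Vecℚ n) → c · (⊖ x) ≡ - (c · x)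
·-⊖ c x = trans (·-congʳ c (λ i → solve 1 (λ x → :- x := :- con 1ℚ :* x) refl (x i)))
         (trans (·-⊙ c (- 1ℚ) x) (solve 1 (λ y → :- con 1ℚ :* y := :- y) refl (c · x)))

·-𝟎 : ∀ (c : Vecℚ n) → c · 𝟎 ≡ 0ℚ
·-𝟎 {n} c = trans (sumFin-cong (λ i → *-zeroʳ (c i))) (sumFin-zero n)

𝟎-· : ∀ (x : Vecℚ n) → 𝟎 · x ≡ 0ℚ
𝟎-· {n} x = trans (sumFin-cong (λ i → *-zeroˡ (x i))) (sumFin-zero n)

·-e : ∀ (c : Vecℚ n) k → c · e k ≡ c k
·-e c k = trans (sumFin-single _ k (λ j j≢k → trans (cong (c j *_) (e-off (j≢k ∘ sym))) (*-zeroʳ (c j))))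
                (trans (cong (c k *_) (e-diag k)) (*-identityʳ (c k)))

e-· : ∀ k (x : Vecℚ n) → e k · x ≡ x k
e-· k x = trans (·-comm (e k) x) (·-e x k)

lookup-∉ : ∀ {A : Subset n} {i} → i ∉ A → lookup A i ≡ false
lookup-∉ {A = A} {i} i∉A with lookup A i in eq
... | true = contradiction (lookup⇒[]= i A eq) i∉A
... | false = refl

∈∧∉⇒lookup : ∀ {A B : Subset n} {k} → k ∈ A → k ∉ B → lookup A k ∧ not (lookup B k) ≡ true
∈∧∉⇒lookup {A = A} {B} k∈A k∉B rewrite []=⇒lookup k∈A | lookup-∉ {A = B} k∉B = refl

lookup⇒∈∧∉ : ∀ {A B : Subset n} {k} → lookup A k ∧ not (lookup B k) ≡ true → k ∈ A × k ∉ B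
lookup⇒∈∧∉ {A = A} {B} {k} eq with lookup A k in a | lookup B k in b
... | true | false = lookup⇒[]= k A a , λ k∈B → true≢false (trans (sym ([]=⇒lookup k∈B)) b)
  where
  true≢false : true ≢ false
  true≢false ()

∈⇒𝟙≡1 : ∀ {A : Subset n} {i} → i ∈ A → 𝟙 (lookup A) i ≡ 1ℚ
∈⇒𝟙≡1 {A = A} i∈A = 𝟙-true (lookup A) ([]=⇒lookup i∈A)

∉⇒𝟙≡0 : ∀ {A : Subset n} {i} → i ∉ A → 𝟙 (lookup A) i ≡ 0ℚ
∉⇒𝟙≡0 {A = A} i∉A = 𝟙-false (lookup A) (lookup-∉ i∉A)

sumOver≡𝟙· : ∀ (A : Subset n) x → sumOver A x ≡ 𝟙 (lookup A) · x
sumOver≡𝟙· A x = sumFin-cong (λ i → select (lookup A i) (x i))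
  where
  select : ∀ b p → (if b then p else 0ℚ) ≡ (if b then 1ℚ else 0ℚ) * p
  select true p = sym (*-identityˡ p)
  select false p = sym (*-zeroˡ p)

sumOver-cong : ∀ (A : Subset n) {x y} → x ≐ y → sumOver A x ≡ sumOver A y
sumOver-cong A {x} {y} x≐y rewrite sumOver≡𝟙· A x | sumOver≡𝟙· A y = ·-congʳ (𝟙 (lookup A)) x≐y

sumOver-⊕ : ∀ (A : Subset n) x y → sumOver A (x ⊕ y) ≡ sumOver A x + sumOver A y
sumOver-⊕ A x y rewrite sumOver≡𝟙· A (x ⊕ y) | sumOver≡𝟙· A x | sumOver≡𝟙· A y = ·-⊕ʳ (𝟙 (lookup A)) x y

sumOver-⊙ : ∀ (A : Subset n) t x → sumOver A (t ⊙ x) ≡ t * sumOver A x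
sumOver-⊙ A t x rewrite sumOver≡𝟙· A (t ⊙ x) | sumOver≡𝟙· A x = ·-⊙ (𝟙 (lookup A)) t x

sumOver-⊖ : ∀ (A : Subset n) x → sumOver A (⊖ x) ≡ - sumOver A x
sumOver-⊖ A x rewrite sumOver≡𝟙· A (⊖ x) | sumOver≡𝟙· A x = ·-⊖ (𝟙 (lookup A)) x

sumOver-𝟎 : ∀ (A : Subset n) → sumOver A 𝟎 ≡ 0ℚ
sumOver-𝟎 A = trans (sumOver≡𝟙· A 𝟎) (·-𝟎 (𝟙 (lookup A)))

sumOver-e : ∀ (A : Subset n) k → sumOver A (e k) ≡ 𝟙 (lookup A) k
sumOver-e A k = trans (sumOver≡𝟙· A (e k)) (·-e (𝟙 (lookup A)) k)

sumOver-⊥ : ∀ (x : Vecℚ n) → sumOver ⊥ x ≡ 0ℚ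
sumOver-⊥ {n} x = trans (sumOver≡𝟙· ⊥ x) (trans (·-congˡ x 𝟙⊥≐𝟎) (𝟎-· x))
  where
  𝟙⊥≐𝟎 : 𝟙 (lookup (⊥ {n})) ≐ 𝟎
  𝟙⊥≐𝟎 i = 𝟙-false (lookup ⊥) {i} (lookup-∉ {A = ⊥} (∉⊥ {x = i}))

sumOver-∪-∩ : ∀ (A B : Subset n) x → sumOver (A ∪ B) x + sumOver (A ∩ B) x ≡ sumOver A x + sumOver B x
sumOver-∪-∩ A B x
  rewrite sumOver≡𝟙· (A ∪ B) x | sumOver≡𝟙· (A ∩ B) x | sumOver≡𝟙· A x | sumOver≡𝟙· B x
  = trans (sym (·-⊕ˡ (𝟙 (lookup (A ∪ B))) (𝟙 (lookup (A ∩ B))) x))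
      (trans (·-congˡ x pointwise) (·-⊕ˡ (𝟙 (lookup A)) (𝟙 (lookup B)) x))
  where
  pointwise : (𝟙 (lookup (A ∪ B)) ⊕ 𝟙 (lookup (A ∩ B))) ≐ (𝟙 (lookup A) ⊕ 𝟙 (lookup B))
  pointwise i rewrite lookup-zipWith _∨_ i A B | lookup-zipWith _∧_ i A B
    with lookup A i | lookup B i
  ... | true  | true  = refl
  ... | true  | false = +-comm 1ℚ 0ℚ
  ... | false | true  = refl
  ... | false | false = refl

sumOver-∪ : ∀ (A B : Subset n) x →
  sumOver (A ∪ B) x ≡ sumOver B x + 𝟙 (λ k → lookup A k ∧ not (lookup B k)) · x
sumOver-∪ A B x rewrite sumOver≡𝟙· (A ∪ B) x | sumOver≡𝟙· B x = trans (·-congˡ x pointwise) (·-⊕ˡ (𝟙 (lookup B)) _ x)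
  where
  pointwise : 𝟙 (lookup (A ∪ B)) ≐ (𝟙 (lookup B) ⊕ 𝟙 (λ k → lookup A k ∧ not (lookup B k)))
  pointwise i rewrite lookup-zipWith _∨_ i A B with lookup A i | lookup B i
  ... | true  | true  = sym (+-identityʳ 1ℚ)
  ... | true  | false = refl
  ... | false | true  = sym (+-identityʳ 1ℚ)
  ... | false | false = refl

𝟙·-≥-member : ∀ (b : Fin n → Bool) {i} x → b i ≡ true → (∀ k → b k ≡ true → 0ℚ ≤ x k) → x i ≤ 𝟙 b · x
𝟙·-≥-member b {i} x bi 0≤x = subst (_≤ 𝟙 b · x) (weighted true bi) (sumFin-≥-single _ i others)
  where
  weighted : ∀ {k} c → b k ≡ c → 𝟙 b k * x k ≡ (if c then x k else 0ℚ)
  weighted {k} true bk = trans (cong (_* x k) (𝟙-true b bk)) (*-identityˡ (x k))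
  weighted {k} false bk = trans (cong (_* x k) (𝟙-false b bk)) (*-zeroˡ (x k))
  others : ∀ k → k ≢ i → 0ℚ ≤ 𝟙 b k * x k
  others k _ = byValue (b k) refl
    where
    byValue : ∀ c → b k ≡ c → 0ℚ ≤ 𝟙 b k * x k
    byValue true bk = subst (0ℚ ≤_) (sym (weighted true bk)) (0≤x k bk)
    byValue false bk = subst (0ℚ ≤_) (sym (weighted false bk)) ≤-refl

sumOver-∪-positive : ∀ {n} (A B : Subset n) w i → 0ℚ < w i → i ∈ A → i ∉ B → sumOver B w ≡ 0ℚ →
  (∀ k → k ∈ A → k ∉ B → 0ℚ ≤ w k) → 0ℚ < sumOver (A ∪ B) w
sumOver-∪-positive {n} A B w i 0<wi i∈A i∉B wB≡0 0≤w = <-≤-trans 0<wi (begin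
  w i                               ≤⟨ 𝟙·-≥-member A─B w (∈∧∉⇒lookup i∈A i∉B)
                                         (λ k out → let (k∈A , k∉B) = lookup⇒∈∧∉ {A = A} {B} out in 0≤w k k∈A k∉B) ⟩
  𝟙 A─B · w                         ≡⟨ +-identityˡ _ ⟨
  0ℚ + 𝟙 A─B · w                    ≡⟨ cong (_+ 𝟙 A─B · w) wB≡0 ⟨
  sumOver B w + 𝟙 A─B · w           ≡⟨ sumOver-∪ A B w ⟨
  sumOver (A ∪ B) w                 ∎)
  where
  open ≤-Reasoning
  A─B : Fin n → Bool
  A─B k = lookup A k ∧ not (lookup B k)

-- Conic hulls and extremal rays

data ConicHull {I : Set} (r : I → Vecℚ n) : Vecℚ n → Set where
  generator : ∀ i → ConicHull r (r i)
  origin    : ConicHull r 𝟎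
  add       : ∀ {x y} → ConicHull r x → ConicHull r y → ConicHull r (x ⊕ y)
  scale     : ∀ {t x} → 0ℚ ≤ t → ConicHull r x → ConicHull r (t ⊙ x)
  resp-≐    : ∀ {x y} → x ≐ y → ConicHull r x → ConicHull r y

module _ {I J : Set} {r : I → Vecℚ n} {s : J → Vecℚ n} where

  ConicHull-bind : (∀ i → ConicHull s (r i)) → ∀ {w} → ConicHull r w → ConicHull s w
  ConicHull-bind r⊆s (generator i) = r⊆s i
  ConicHull-bind r⊆s origin = origin
  ConicHull-bind r⊆s (add x y) = add (ConicHull-bind r⊆s x) (ConicHull-bind r⊆s y)
  ConicHull-bind r⊆s (scale 0≤t x) = scale 0≤t (ConicHull-bind r⊆s x)
  ConicHull-bind r⊆s (resp-≐ x≐y x) = resp-≐ x≐y (ConicHull-bind r⊆s x)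

ConicHull-closed : ∀ {I : Set} {r : I → Vecℚ n} (C : Vecℚ n → Set) →
  C 𝟎 → (∀ {x y} → C x → C y → C (x ⊕ y)) → (∀ {t x} → 0ℚ ≤ t → C x → C (t ⊙ x)) →
  (∀ {x y} → x ≐ y → C x → C y) → (∀ i → C (r i)) → ∀ {w} → ConicHull r w → C w
ConicHull-closed C C𝟎 C⊕ C⊙ C≐ Cr (generator i) = Cr i
ConicHull-closed C C𝟎 C⊕ C⊙ C≐ Cr origin = C𝟎
ConicHull-closed C C𝟎 C⊕ C⊙ C≐ Cr (add x y) = C⊕ (ConicHull-closed C C𝟎 C⊕ C⊙ C≐ Cr x) (ConicHull-closed C C𝟎 C⊕ C⊙ C≐ Cr y)
ConicHull-closed C C𝟎 C⊕ C⊙ C≐ Cr (scale 0≤t x) = C⊙ 0≤t (ConicHull-closed C C𝟎 C⊕ C⊙ C≐ Cr x)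
ConicHull-closed C C𝟎 C⊕ C⊙ C≐ Cr (resp-≐ x≐y x) = C≐ x≐y (ConicHull-closed C C𝟎 C⊕ C⊙ C≐ Cr x)

conicComb∈ConicHull : ∀ {l} (r : Fin l → Vecℚ n) (λs : Fin l → ℚ) → (∀ k → 0ℚ ≤ λs k) →
  ConicHull r (conicComb λs r)
conicComb∈ConicHull {l = zero} r λs 0≤λs = resp-≐ (λ i → refl) origin
conicComb∈ConicHull {l = suc l} r λs 0≤λs =
  add (scale (0≤λs zero) (generator zero))
      (ConicHull-bind (generator ∘ suc) (conicComb∈ConicHull (r ∘ suc) (λs ∘ suc) (0≤λs ∘ suc)))

ConicHull⇒conicComb : ∀ {l} {r : Fin l → Vecℚ n} {w} → ConicHull r w →
  Σ (Fin l → ℚ) λ λs → (∀ k → 0ℚ ≤ λs k) × w ≐ conicComb λs r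
ConicHull⇒conicComb {r = r} (generator k) = e k , 𝟙-nonNeg _ , λ i → sym (e-· k (λ h → r h i))
ConicHull⇒conicComb {r = r} origin = 𝟎 , (λ _ → ≤-refl) , λ i → sym (𝟎-· (λ h → r h i))
ConicHull⇒conicComb {r = r} (add x y) with ConicHull⇒conicComb x | ConicHull⇒conicComb y
... | λx , 0≤λx , x≐ | λy , 0≤λy , y≐ =
  λx ⊕ λy , (λ k → +-mono-≤ (0≤λx k) (0≤λy k)) ,
  λ i → trans (cong₂ _+_ (x≐ i) (y≐ i)) (sym (·-⊕ˡ λx λy (λ h → r h i)))
ConicHull⇒conicComb {r = r} (scale {t} 0≤t x) with ConicHull⇒conicComb x
... | λx , 0≤λx , x≐ =
  t ⊙ λx , (λ k → nonNeg*nonNeg 0≤t (0≤λx k)) ,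
  λ i → trans (cong (t *_) (x≐ i)) (sym (·-⊙ˡ t λx (λ h → r h i)))
ConicHull⇒conicComb (resp-≐ x≐y x) with ConicHull⇒conicComb x
... | λx , 0≤λx , x≐ = λx , 0≤λx , λ i → trans (sym (x≐y i)) (x≐ i)

generatedBy-ConicHull : ∀ {l} (C : Vecℚ n → Set) (r : Fin l → Vecℚ n) →
  (∀ {w} → C w → ConicHull r w) → (∀ {w} → ConicHull r w → C w) → GeneratedBy C r
generatedBy-ConicHull C r C⊆hull hull⊆C w =
  (λ Cw → ConicHull⇒conicComb (C⊆hull Cw)) ,
  -- This clause asks for one coefficient vector; any will do, as nonnegative combinations lie in C.
  ((λ _ → 0ℚ) , λ (0≤λs , w≐) →
    hull⊆C (resp-≐ (λ i → sym (w≐ i)) (conicComb∈ConicHull r (λ _ → 0ℚ) 0≤λs)))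

IsExtremalRayGenerator-resp : ∀ {C D : Vecℚ n → Set} {g} →
  (∀ {w} → C w → D w) → (∀ {w} → D w → C w) →
  IsExtremalRayGenerator C g → IsExtremalRayGenerator D g
IsExtremalRayGenerator-resp C⊆D D⊆C (Cg , g≢𝟎 , split) =
  C⊆D Cg , g≢𝟎 , λ a b Da Db g≐a+b → split a b (D⊆C Da) (D⊆C Db) g≐a+b

module Separation {I : Set} (r : I → Vecℚ n) (c : Vecℚ n) {g : Vecℚ n}
                  (separates : ∀ i → c · r i ≤ 0ℚ ⊎ r i ≐ g) where

  split-along : ∀ {a} → ConicHull r a →
    Σ ℚ λ s → 0ℚ ≤ s × Σ (Vecℚ n) λ a' → ConicHull r a' × c · a' ≤ 0ℚ × a ≐ ((s ⊙ g) ⊕ a')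
  split-along (generator i) with separates i
  ... | inj₁ c·ri≤0 = 0ℚ , ≤-refl , r i , generator i , c·ri≤0 ,
                      λ k → solve 2 (λ x y → x := con 0ℚ :* y :+ x) refl (r i k) (g k)
  ... | inj₂ ri≐g = 1ℚ , 0≤1 , 𝟎 , origin , ≤-reflexive (·-𝟎 c) ,
                    λ k → trans (ri≐g k) (solve 1 (λ y → y := con 1ℚ :* y :+ con 0ℚ) refl (g k))
  split-along origin = 0ℚ , ≤-refl , 𝟎 , origin , ≤-reflexive (·-𝟎 c) ,
                       λ k → solve 1 (λ y → con 0ℚ := con 0ℚ :* y :+ con 0ℚ) refl (g k)
  split-along (add x y) with split-along x | split-along y
  ... | s , 0≤s , x' , hx' , c·x'≤0 , x≐ | t , 0≤t , y' , hy' , c·y'≤0 , y≐ =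
    s + t , +-mono-≤ 0≤s 0≤t , x' ⊕ y' , add hx' hy' ,
    subst (_≤ 0ℚ) (sym (·-⊕ʳ c x' y')) (+-mono-≤ c·x'≤0 c·y'≤0 ) ,
    λ k → trans (cong₂ _+_ (x≐ k) (y≐ k))
      (solve 5 (λ s t a b y → (s :* y :+ a) :+ (t :* y :+ b) := (s :+ t) :* y :+ (a :+ b)) refl s t (x' k) (y' k) (g k))
  split-along (scale {t} 0≤t x) with split-along x
  ... | s , 0≤s , x' , hx' , c·x'≤0 , x≐ =
    t * s , nonNeg*nonNeg 0≤t 0≤s , t ⊙ x' , scale 0≤t hx' ,
    subst (_≤ 0ℚ) (sym (·-⊙ c t x')) (nonNeg*nonPos 0≤t c·x'≤0) ,
    λ k → trans (cong (t *_) (x≐ k))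
      (solve 4 (λ t s a y → t :* (s :* y :+ a) := t :* s :* y :+ t :* a) refl t s (x' k) (g k))
  split-along (resp-≐ x≐y x) with split-along x
  ... | s , 0≤s , x' , hx' , c·x'≤0 , x≐ = s , 0≤s , x' , hx' , c·x'≤0 , λ k → trans (sym (x≐y k)) (x≐ k)

  module _ (pointed : ∀ {w} → ConicHull r w → ConicHull r (⊖ w) → w ≐ 𝟎)
           (hull-g : ConicHull r g) (0<c·g : 0ℚ < c · g) where

    summand-multiple : ∀ {a b} → ConicHull r a → ConicHull r b → g ≐ (a ⊕ b) →
      Σ ℚ λ s → 0ℚ ≤ s × a ≐ (s ⊙ g)
    summand-multiple {a} {b} ha hb g≐a⊕b with split-along ha | split-along hb
    ... | s , 0≤s , a' , ha' , c·a'≤0 , a≐ | t , 0≤t , b' , hb' , c·b'≤0 , b≐ = s , 0≤s , a≐s⊙g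
      where
      u : ℚ
      u = s + t

      g≐ : g ≐ ((u ⊙ g) ⊕ (a' ⊕ b'))
      g≐ k = trans (g≐a⊕b k) (trans (cong₂ _+_ (a≐ k) (b≐ k))
        (solve 5 (λ s t a b y → (s :* y :+ a) :+ (t :* y :+ b) := (s :+ t) :* y :+ (a :+ b)) refl s t (a' k) (b' k) (g k)))

      c·g≡ : c · g ≡ u * (c · g) + (c · a' + c · b')
      c·g≡ = trans (·-congʳ c g≐) (trans (·-⊕ʳ c (u ⊙ g) (a' ⊕ b')) (cong₂ _+_ (·-⊙ c u g) (·-⊕ʳ c a' b')))

      1≤u : 1ℚ ≤ u
      1≤u = x≡u*x+y⇒1≤u 0<c·g (+-mono-≤ c·a'≤0 c·b'≤0) c·g≡

      ⊖a'≐ : (((u - 1ℚ) ⊙ g) ⊕ b') ≐ (⊖ a')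
      ⊖a'≐ k = sym (begin
        - a' k
          ≡⟨ solve 4 (λ y u a b → :- a := (u :- con 1ℚ) :* y :+ b :- (u :* y :+ (a :+ b) :- y)) refl (g k) u (a' k) (b' k) ⟩
        (u - 1ℚ) * g k + b' k - (u * g k + (a' k + b' k) - g k)
          ≡⟨ cong (λ h → (u - 1ℚ) * g k + b' k - (h - g k)) (sym (g≐ k)) ⟩
        (u - 1ℚ) * g k + b' k - (g k - g k)
          ≡⟨ solve 2 (λ z y → z :- (y :- y) := z) refl ((u - 1ℚ) * g k + b' k) (g k) ⟩
        (u - 1ℚ) * g k + b' k ∎)
        where open ≡-Reasoning

      a'≐𝟎 : a' ≐ 𝟎
      a'≐𝟎 = pointed ha' (resp-≐ ⊖a'≐ (add (scale (p≤q⇒0≤q-p 1≤u) hull-g) hb'))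

      a≐s⊙g : a ≐ (s ⊙ g)
      a≐s⊙g k = trans (a≐ k) (trans (cong (s * g k +_) (a'≐𝟎 k)) (+-identityʳ (s * g k)))

    separated⇒extremal : IsExtremalRayGenerator (ConicHull r) g
    separated⇒extremal =
      hull-g ,
      (λ g≐𝟎 → <-irrefl (sym (trans (·-congʳ c g≐𝟎) (·-𝟎 c))) 0<c·g) ,
      λ a b ha hb g≐a⊕b → summand-multiple ha hb g≐a⊕b ,
                          summand-multiple hb ha (λ k → trans (g≐a⊕b k) (+-comm (a k) (b k)))

-- Tangent cones

TangentCone-pointed : ∀ {P : Vecℚ n → Set} {v w} → IsVertex P v →
  TangentCone P v w → TangentCone P v (⊖ w) → w ≐ 𝟎
TangentCone-pointed {v = v} {w} (_ , extreme) (ε , 0<ε , Py) (δ , 0<δ , Pz) i =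
  pos*p≡0⇒p≡0 0<ε (cancel (proj₁ split i))
  where
  -- v is the point of the segment from v + ε w to v − δ w with weight δ / (ε + δ) on the first end.
  σ : ℚ
  σ = ε + δ
  0<σ : 0ℚ < σ
  0<σ = +-mono-< 0<ε 0<δ
  instance
    σ≢0 : NonZero σ
    σ≢0 = pos⇒nonZero σ {{positive 0<σ}}
  t : ℚ
  t = δ * 1/ σ
  σ[1/σ]≡1 : σ * 1/ σ ≡ 1ℚ
  σ[1/σ]≡1 = *-inverseʳ σ
  1-t≡ : 1ℚ - t ≡ ε * 1/ σ
  1-t≡ = begin
    1ℚ - δ * 1/ σ            ≡⟨ cong (_- δ * 1/ σ) (sym σ[1/σ]≡1) ⟩
    σ * 1/ σ - δ * 1/ σ      ≡⟨ solve 3 (λ ε δ d → (ε :+ δ) :* d :- δ :* d := ε :* d) refl ε δ (1/ σ) ⟩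
    ε * 1/ σ                 ∎
    where open ≡-Reasoning
  0<1/σ : 0ℚ < 1/ σ
  0<1/σ = positive⁻¹ _ {{1/pos⇒pos σ {{positive 0<σ}}}}
  0<t : 0ℚ < t
  0<t = positive⁻¹ _ {{pos*pos⇒pos δ {{positive 0<δ}} (1/ σ) {{positive 0<1/σ}}}}
  t<1 : t < 1ℚ
  t<1 = 0<q-p⇒p<q (subst (0ℚ <_) (sym 1-t≡) (positive⁻¹ _ {{pos*pos⇒pos ε {{positive 0<ε}} (1/ σ) {{positive 0<1/σ}}}}))
  v≐ : v ≐ ((t ⊙ (v ⊕ (ε ⊙ w))) ⊕ ((1ℚ - t) ⊙ (v ⊕ (δ ⊙ (⊖ w)))))
  v≐ k = sym (begin
    t * (v k + ε * w k) + (1ℚ - t) * (v k + δ * - w k)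
      ≡⟨ solve 5 (λ x y ε δ d → δ :* d :* (x :+ ε :* y) :+ (con 1ℚ :- δ :* d) :* (x :+ δ :* (:- y))
                             := x :+ δ :* y :* ((ε :+ δ) :* d :- con 1ℚ)) refl (v k) (w k) ε δ (1/ σ) ⟩
    v k + δ * w k * (σ * 1/ σ - 1ℚ)
      ≡⟨ cong (λ h → v k + δ * w k * (h - 1ℚ)) σ[1/σ]≡1 ⟩
    v k + δ * w k * (1ℚ - 1ℚ)
      ≡⟨ solve 3 (λ x δ y → x :+ δ :* y :* (con 1ℚ :- con 1ℚ) := x) refl (v k) δ (w k) ⟩
    v k ∎)
    where open ≡-Reasoning
  split : (v ⊕ (ε ⊙ w)) ≐ v × (v ⊕ (δ ⊙ (⊖ w))) ≐ v
  split = extreme _ _ t Py Pz 0<t t<1 v≐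
  cancel : v i + ε * w i ≡ v i → ε * w i ≡ 0ℚ
  cancel eq = trans (solve 2 (λ x y → y := (x :+ y) :- x) refl (v i) (ε * w i)) (trans (cong (_- v i) eq) (+-inverseʳ (v i)))

ScalesBelow : ℚ → ℚ → ℚ → Set
ScalesBelow ε p q = ∀ ε' → 0ℚ ≤ ε' → ε' ≤ ε → ε' * p ≤ q

ScalesBelow-mono : ∀ {ε δ p q} → δ ≤ ε → ScalesBelow ε p q → ScalesBelow δ p q
ScalesBelow-mono δ≤ε below ε' 0≤ε' ε'≤δ = below ε' 0≤ε' (≤-trans ε'≤δ δ≤ε)

small-scaling : ∀ p q → 0ℚ ≤ q → (q ≡ 0ℚ → p ≤ 0ℚ) → Σ ℚ λ ε → 0ℚ < ε × ScalesBelow ε p q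
small-scaling p q 0≤q q≡0⇒p≤0 with 0ℚ <? p
... | no p≯0 = 1ℚ , positive⁻¹ 1ℚ , λ ε' 0≤ε' _ → ≤-trans (nonNeg*nonPos 0≤ε' (≮⇒≥ p≯0)) 0≤q
... | yes 0<p = q * 1/ p , 0<ε , λ ε' _ ε'≤ε →
  ≤-trans (*-monoʳ-≤-nonNeg p {{nonNegative (<⇒≤ 0<p)}} ε'≤ε) (≤-reflexive εp≡q)
  where
  instance
    p≢0 : NonZero p
    p≢0 = pos⇒nonZero p {{positive 0<p}}
  0<q : 0ℚ < q
  0<q = ≤∧≢⇒< 0≤q (λ 0≡q → <⇒≱ 0<p (q≡0⇒p≤0 (sym 0≡q)))
  0<ε : 0ℚ < q * 1/ p
  0<ε = positive⁻¹ _ {{pos*pos⇒pos q {{positive 0<q}} (1/ p) {{1/pos⇒pos p {{positive 0<p}}}}}}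
  εp≡q : q * 1/ p * p ≡ q
  εp≡q = trans (*-assoc q (1/ p) p) (trans (cong (q *_) (*-inverseˡ p)) (*-identityʳ q))

small-scalings : ∀ {X : Set} (f g : X → ℚ) → (∀ x → 0ℚ ≤ g x) → (∀ x → g x ≡ 0ℚ → f x ≤ 0ℚ) →
  ∀ xs → Σ ℚ λ ε → 0ℚ < ε × (∀ x → x ∈ₗ xs → ScalesBelow ε (f x) (g x))
small-scalings f g 0≤g g≡0⇒f≤0 [] = 1ℚ , positive⁻¹ 1ℚ , λ _ ()
small-scalings f g 0≤g g≡0⇒f≤0 (x ∷ xs)
  with small-scaling (f x) (g x) (0≤g x) (g≡0⇒f≤0 x) | small-scalings f g 0≤g g≡0⇒f≤0 xs
... | ε , 0<ε , below-x | δ , 0<δ , below-xs = ε ⊓ δ , pos⊓pos 0<ε 0<δ , below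
  where
  below : ∀ y → y ∈ₗ x ∷ xs → ScalesBelow (ε ⊓ δ) (f y) (g y)
  below _ (here refl) = ScalesBelow-mono (p⊓q≤p ε δ) below-x
  below y (there y∈xs) = ScalesBelow-mono (p⊓q≤q ε δ) (below-xs y y∈xs)

<-rec-on : ∀ {A : Set} (μ : A → ℕ) (P : A → Set) → (∀ x → (∀ {y} → μ y ℕ.< μ x → P y) → P x) → ∀ x → P x
<-rec-on μ = WF.All.wfRec (On.wellFounded μ ℕ.<-wellFounded) 0ℓ

allSubsets : ∀ n → List (Subset n)
allSubsets zero = [] ∷ []
allSubsets (suc n) = map (inside ∷_) (allSubsets n) ++ map (outside ∷_) (allSubsets n)

∈-allSubsets : ∀ (A : Subset n) → A ∈ₗ allSubsets n
∈-allSubsets [] = here refl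
∈-allSubsets {suc n} (inside ∷ A) = ∈-++⁺ˡ (∈-map⁺ (inside ∷_) (∈-allSubsets A))
∈-allSubsets {suc n} (outside ∷ A) = ∈-++⁺ʳ (map (inside ∷_) (allSubsets n)) (∈-map⁺ (outside ∷_) (∈-allSubsets A))

module _ {X : Set} where

  count : {P : X → Set} → (∀ x → Dec (P x)) → List X → ℕ
  count P? [] = 0
  count P? (x ∷ xs) with P? x
  ... | yes _ = suc (count P? xs)
  ... | no _ = count P? xs

  count-mono : {P Q : X → Set} (P? : ∀ x → Dec (P x)) (Q? : ∀ x → Dec (Q x)) →
    (∀ x → P x → Q x) → ∀ xs → count P? xs ℕ.≤ count Q? xs
  count-mono P? Q? P⇒Q [] = z≤n
  count-mono P? Q? P⇒Q (x ∷ xs) with P? x | Q? x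
  ... | yes _  | yes _  = s≤s (count-mono P? Q? P⇒Q xs)
  ... | yes Px | no ¬Qx = contradiction (P⇒Q x Px) ¬Qx
  ... | no _   | yes _  = ℕ.m≤n⇒m≤1+n (count-mono P? Q? P⇒Q xs)
  ... | no _   | no _   = count-mono P? Q? P⇒Q xs

  count-< : {P Q : X → Set} (P? : ∀ x → Dec (P x)) (Q? : ∀ x → Dec (Q x)) →
    (∀ x → P x → Q x) → ∀ {y} xs → y ∈ₗ xs → Q y → ¬ P y → count P? xs ℕ.< count Q? xs
  count-< P? Q? P⇒Q (x ∷ xs) (here refl) Qy ¬Py with P? x | Q? x
  ... | yes Py | _      = contradiction Py ¬Py
  ... | no _   | yes _  = s≤s (count-mono P? Q? P⇒Q xs)
  ... | no _   | no ¬Qy = contradiction Qy ¬Qy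
  count-< P? Q? P⇒Q (x ∷ xs) (there y∈xs) Qy ¬Py with P? x | Q? x
  ... | yes _  | yes _  = s≤s (count-< P? Q? P⇒Q xs y∈xs Qy ¬Py)
  ... | yes Px | no ¬Qx = contradiction (P⇒Q x Px) ¬Qx
  ... | no _   | yes _  = ℕ.m≤n⇒m≤1+n (count-< P? Q? P⇒Q xs y∈xs Qy ¬Py)
  ... | no _   | no _   = count-< P? Q? P⇒Q xs y∈xs Qy ¬Py

module _ {P : Subset n → Set} where

  ⋃-closed : P ⊥ → (∀ {A B} → P A → P B → P (A ∪ B)) → ∀ {xs} → All P xs → P (⋃ xs)
  ⋃-closed P⊥ P∪ [] = P⊥
  ⋃-closed P⊥ P∪ (PA ∷ Pxs) = P∪ PA (⋃-closed P⊥ P∪ Pxs)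

  ⋂-closed : (∀ {A B} → P A → P B → P (A ∩ B)) → ∀ {A xs} → All P (A ∷ xs) → P (⋂ (A ∷ xs))
  ⋂-closed P∩ {A} (PA ∷ []) = subst P (sym (∩-identityʳ A)) PA
  ⋂-closed P∩ (PA ∷ PB ∷ Pxs) = P∩ PA (⋂-closed P∩ (PB ∷ Pxs))

⊆-⋃ : ∀ {A : Subset n} {xs} → A ∈ₗ xs → A ⊆ ⋃ xs
⊆-⋃ {xs = B ∷ xs} (here refl) = p⊆p∪q (⋃ xs)
⊆-⋃ {xs = B ∷ xs} (there A∈xs) = q⊆p∪q B (⋃ xs) ∘ ⊆-⋃ A∈xs

⋂-⊆ : ∀ {A : Subset n} {xs} → A ∈ₗ xs → ⋂ xs ⊆ A
⋂-⊆ {xs = B ∷ xs} (here refl) = p∩q⊆p B (⋂ xs)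
⋂-⊆ {xs = B ∷ xs} (there A∈xs) = ⋂-⊆ A∈xs ∘ p∩q⊆q B (⋂ xs)

-- Rays

data Ray (n : ℕ) : Set where
  up    : Fin n → Ray n
  down  : Fin n → Ray n
  shift : Fin n → Fin n → Ray n

ray : ∀ {n} → Ray n → Vecℚ n
ray (up i)      = e i
ray (down j)    = ⊖ e j
ray (shift i j) = e i ⊕ (⊖ e j)

allRays : ∀ n → List (Ray n)
allRays n = map up (allFin n) ++ map down (allFin n) ++ cartesianProductWith shift (allFin n) (allFin n)

∈-allRays : ∀ {n} (d : Ray n) → d ∈ₗ allRays n
∈-allRays {n} (up i) = ∈-++⁺ˡ (∈-map⁺ up (∈-allFin i))
∈-allRays {n} (down j) = ∈-++⁺ʳ (map up (allFin n)) (∈-++⁺ˡ (∈-map⁺ down (∈-allFin j)))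
∈-allRays {n} (shift i j) = ∈-++⁺ʳ (map up (allFin n)) (∈-++⁺ʳ (map down (allFin n))
  (∈-cartesianProductWith⁺ shift (∈-allFin i) (∈-allFin j)))

evaluate : ∀ {n} → Vecℚ n → Ray n → ℚ
evaluate c (up i)      = c i
evaluate c (down j)    = - c j
evaluate c (shift i j) = c i - c j

·-ray : ∀ {n} (c : Vecℚ n) d → c · ray d ≡ evaluate c d
·-ray c (up i) = ·-e c i
·-ray c (down j) = trans (·-⊖ c (e j)) (cong -_ (·-e c j))
·-ray c (shift i j) = trans (·-⊕ʳ c (e i) (⊖ e j)) (cong₂ _+_ (·-e c i) (trans (·-⊖ c (e j)) (cong -_ (·-e c j))))

sumOver-shift : ∀ {n} (A : Subset n) i j → sumOver A (e i ⊕ (⊖ e j)) ≡ 𝟙 (lookup A) i - 𝟙 (lookup A) j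
sumOver-shift A i j = trans (sumOver-⊕ A (e i) (⊖ e j))
  (cong₂ _+_ (sumOver-e A i) (trans (sumOver-⊖ A (e j)) (cong -_ (sumOver-e A j))))

shift-at-i : ∀ {n} {i j : Fin n} → i ≢ j → (e i ⊕ (⊖ e j)) i ≡ 1ℚ
shift-at-i {i = i} i≢j = trans (cong₂ (λ x y → x + - y) (e-diag i) (e-off (i≢j ∘ sym))) (+-identityʳ 1ℚ)

shift-off-j : ∀ {n} {i j k : Fin n} → j ≢ k → (e i ⊕ (⊖ e j)) k ≡ e i k
shift-off-j {i = i} {k = k} j≢k = trans (cong (λ x → e i k + - x) (e-off j≢k)) (+-identityʳ (e i k))

shift-off : ∀ {n} {i j k : Fin n} → i ≢ k → j ≢ k → (e i ⊕ (⊖ e j)) k ≡ 0ℚ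
shift-off i≢k j≢k = trans (shift-off-j j≢k) (e-off i≢k)

peel : ∀ {n} → ℚ → Vecℚ n → Vecℚ n → Vecℚ n
peel t d w = w ⊕ ((- t) ⊙ d)

peel-restore : ∀ {n} t (d w : Vecℚ n) → (peel t d w ⊕ (t ⊙ d)) ≐ w
peel-restore t d w k = solve 3 (λ x t y → x :+ (:- t) :* y :+ t :* y := x) refl (w k) t (d k)

sumOver-peel : ∀ {n} (A : Subset n) t d w → sumOver A (peel t d w) ≡ sumOver A w - t * sumOver A d
sumOver-peel A t d w = trans (sumOver-⊕ A w ((- t) ⊙ d))
  (trans (cong (sumOver A w +_) (sumOver-⊙ A (- t) d)) (cong (sumOver A w +_) (sym (neg-distribˡ-* t (sumOver A d)))))

peel-e-at : ∀ {n} t (i : Fin n) w → peel t (e i) w i ≡ w i - t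
peel-e-at t i w = trans (cong (λ x → w i + (- t) * x) (e-diag i)) (cong (w i +_) (*-identityʳ (- t)))

peel-off : ∀ {n} t (d w : Vecℚ n) {k} → d k ≡ 0ℚ → peel t d w k ≡ w k
peel-off t d w {k} dk≡0 =
  trans (cong (λ x → w k + (- t) * x) dk≡0) (trans (cong (w k +_) (*-zeroʳ (- t))) (+-identityʳ (w k)))

-- The tangent cone at a vertex of a polymatroid

module AtVertex {n : ℕ} {ψ : Subset n → ℤ} (hψ : IsIntegralPolymatroid ψ)
                {v : Vecℚ n} (hv : IsVertex (Polymatroid ψ) v) where

  open IsIntegralPolymatroid hψ

  v∈P : Polymatroid ψ v
  v∈P = proj₁ hv

  Tight : Subset n → Set
  Tight A = sumOver A v ≡ toℚ (ψ A)

  tight? : ∀ A → Dec (Tight A)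
  tight? A = sumOver A v ≟ toℚ (ψ A)

  tight-⊥ : Tight ⊥
  tight-⊥ = trans (sumOver-⊥ v) (sym (cong toℚ empty))

  -- Submodularity of ψ against modularity of A ↦ sumOver A v.
  tight-∪-∩ : ∀ {A B} → Tight A → Tight B → Tight (A ∪ B) × Tight (A ∩ B)
  tight-∪-∩ {A} {B} tA tB = +-squeeze (proj₁ v∈P (A ∪ B)) (proj₁ v∈P (A ∩ B)) (begin
    toℚ (ψ (A ∪ B)) + toℚ (ψ (A ∩ B))     ≡⟨ toℚ-+ (ψ (A ∪ B)) (ψ (A ∩ B)) ⟨
    toℚ (ψ (A ∪ B) ℤ.+ ψ (A ∩ B))         ≤⟨ toℚ-mono (submodular A B) ⟩
    toℚ (ψ A ℤ.+ ψ B)                     ≡⟨ toℚ-+ (ψ A) (ψ B) ⟩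
    toℚ (ψ A) + toℚ (ψ B)                 ≡⟨ cong₂ _+_ tA tB ⟨
    sumOver A v + sumOver B v             ≡⟨ sumOver-∪-∩ A B v ⟨
    sumOver (A ∪ B) v + sumOver (A ∩ B) v ∎)
    where open ≤-Reasoning

  slack : Subset n → ℚ
  slack A = toℚ (ψ A) - sumOver A v

  slack-nonNeg : ∀ A → 0ℚ ≤ slack A
  slack-nonNeg A = p≤q⇒0≤q-p (proj₁ v∈P A)

  slack≡0⇒tight : ∀ {A} → slack A ≡ 0ℚ → Tight A
  slack≡0⇒tight {A} slack≡0 = sym (trans (solve 2 (λ s ψ → ψ := ψ :- s :+ s) refl (sumOver A v) (toℚ (ψ A)))
    (trans (cong (_+ sumOver A v) slack≡0) (+-identityˡ (sumOver A v))))

  record Feasible (w : Vecℚ n) : Set where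
    field
      tight-nonPos : ∀ A → Tight A → sumOver A w ≤ 0ℚ
      zero-nonNeg  : ∀ i → v i ≡ 0ℚ → 0ℚ ≤ w i

  open Feasible

  Feasible-resp : ∀ {w w'} → w ≐ w' → Feasible w → Feasible w'
  Feasible-resp w≐w' fw = record
    { tight-nonPos = λ A tA → subst (_≤ 0ℚ) (sumOver-cong A w≐w') (tight-nonPos fw A tA)
    ; zero-nonNeg  = λ i vi≡0 → subst (0ℚ ≤_) (w≐w' i) (zero-nonNeg fw i vi≡0)
    }

  Feasible-𝟎 : Feasible 𝟎
  Feasible-𝟎 = record
    { tight-nonPos = λ A _ → ≤-reflexive (sumOver-𝟎 A)
    ; zero-nonNeg  = λ _ _ → ≤-refl
    }

  Feasible-⊕ : ∀ {w w'} → Feasible w → Feasible w' → Feasible (w ⊕ w')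
  Feasible-⊕ {w} {w'} fw fw' = record
    { tight-nonPos = λ A tA → subst (_≤ 0ℚ) (sym (sumOver-⊕ A w w'))
                                (+-mono-≤ (tight-nonPos fw A tA) (tight-nonPos fw' A tA))
    ; zero-nonNeg  = λ i vi≡0 → +-mono-≤ (zero-nonNeg fw i vi≡0) (zero-nonNeg fw' i vi≡0)
    }

  Feasible-⊙ : ∀ {t w} → 0ℚ ≤ t → Feasible w → Feasible (t ⊙ w)
  Feasible-⊙ {t} {w} 0≤t fw = record
    { tight-nonPos = λ A tA → subst (_≤ 0ℚ) (sym (sumOver-⊙ A t w)) (nonNeg*nonPos 0≤t (tight-nonPos fw A tA))
    ; zero-nonNeg  = λ i vi≡0 → nonNeg*nonNeg 0≤t (zero-nonNeg fw i vi≡0)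
    }

  tangent⇒feasible : ∀ {w} → TangentCone (Polymatroid ψ) v w → Feasible w
  tangent⇒feasible {w} (ε , 0<ε , sums≤ψ , coords≥0) = record
    { tight-nonPos = λ A tA → *-cancelˡ-≤-pos ε {{positive 0<ε}} (subst₂ _≤_ refl (sym (*-zeroʳ ε)) (step A tA))
    ; zero-nonNeg  = λ i vi≡0 → *-cancelˡ-≤-pos ε {{positive 0<ε}}
        (subst₂ _≤_ (sym (*-zeroʳ ε)) (trans (cong (_+ ε * w i) vi≡0) (+-identityˡ (ε * w i))) (coords≥0 i))
    }
    where
    step : ∀ A → Tight A → ε * sumOver A w ≤ 0ℚ
    step A tA = subst (_≤ 0ℚ) (solve 2 (λ a b → a :+ b :- a := b) refl (sumOver A v) (ε * sumOver A w))
      (p≤q⇒p-q≤0 (subst₂ _≤_ (trans (sumOver-⊕ A v (ε ⊙ w)) (cong (sumOver A v +_) (sumOver-⊙ A ε w))) (sym tA) (sums≤ψ A)))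

  feasible⇒tangent : ∀ {w} → Feasible w → TangentCone (Polymatroid ψ) v w
  feasible⇒tangent {w} fw = combine
    (small-scalings (λ A → sumOver A w) slack slack-nonNeg
       (λ A slack≡0 → tight-nonPos fw A (slack≡0⇒tight slack≡0)) (allSubsets n))
    (small-scalings (λ i → - w i) v (proj₂ v∈P)
       (λ i vi≡0 → neg-antimono-≤ (zero-nonNeg fw i vi≡0)) (allFin n))
    where
    combine : (Σ ℚ λ ε → 0ℚ < ε × (∀ A → A ∈ₗ allSubsets n → ScalesBelow ε (sumOver A w) (slack A))) →
              (Σ ℚ λ δ → 0ℚ < δ × (∀ i → i ∈ₗ allFin n → ScalesBelow δ (- w i) (v i))) →
              TangentCone (Polymatroid ψ) v w
    combine (ε , 0<ε , sums-below) (δ , 0<δ , coords-below) = ε ⊓ δ , pos⊓pos 0<ε 0<δ , sums≤ψ , coords≥0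
      where
      0≤ε⊓δ : 0ℚ ≤ ε ⊓ δ
      0≤ε⊓δ = <⇒≤ (pos⊓pos 0<ε 0<δ)
      sums≤ψ : ∀ A → sumOver A (v ⊕ ((ε ⊓ δ) ⊙ w)) ≤ toℚ (ψ A)
      sums≤ψ A = begin
        sumOver A (v ⊕ ((ε ⊓ δ) ⊙ w))        ≡⟨ trans (sumOver-⊕ A v _) (cong (sumOver A v +_) (sumOver-⊙ A (ε ⊓ δ) w)) ⟩
        sumOver A v + (ε ⊓ δ) * sumOver A w  ≤⟨ +-monoʳ-≤ (sumOver A v)
                                                   (sums-below A (∈-allSubsets A) (ε ⊓ δ) 0≤ε⊓δ (p⊓q≤p ε δ)) ⟩
        sumOver A v + slack A                ≡⟨ solve 2 (λ s ψ → s :+ (ψ :- s) := ψ) refl (sumOver A v) (toℚ (ψ A)) ⟩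
        toℚ (ψ A)                            ∎
        where open ≤-Reasoning
      coords≥0 : ∀ i → 0ℚ ≤ v i + (ε ⊓ δ) * w i
      coords≥0 i = subst (0ℚ ≤_) (solve 3 (λ x t y → x :- t :* (:- y) := x :+ t :* y) refl (v i) (ε ⊓ δ) (w i))
        (p≤q⇒0≤q-p (coords-below i (∈-allFin i) (ε ⊓ δ) 0≤ε⊓δ (p⊓q≤q ε δ)))

  Feasible-pointed : ∀ {w} → Feasible w → Feasible (⊖ w) → w ≐ 𝟎
  Feasible-pointed fw f⊖w = TangentCone-pointed hv (feasible⇒tangent fw) (feasible⇒tangent f⊖w)

  Free : Fin n → Set
  Free i = ∀ A → Tight A → i ∉ A

  record _↝_ (i j : Fin n) : Set where
    field
      distinct : i ≢ j
      support  : v j ≢ 0ℚ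
      forces   : ∀ A → Tight A → i ∈ A → j ∈ A

  open _↝_

  free? : ∀ i → Dec (Free i)
  free? i with anySubset? (λ A → tight? A ×-dec i ∈? A)
  ... | yes (A , tA , i∈A) = no λ free → free A tA i∈A
  ... | no ∄A = yes λ A tA i∈A → ∄A (A , tA , i∈A)

  ¬free⇒tight-set : ∀ {i} → ¬ Free i → Σ (Subset n) λ A → Tight A × i ∈ A
  ¬free⇒tight-set {i} ¬free with anySubset? (λ A → tight? A ×-dec i ∈? A)
  ... | yes witness = witness
  ... | no ∄A = contradiction (λ A tA i∈A → ∄A (A , tA , i∈A)) ¬free

  _↝?_ : ∀ i j → Dec (i ↝ j)
  i ↝? j with i Fin.≟ j | v j ≟ 0ℚ | anySubset? (λ A → tight? A ×-dec i ∈? A ×-dec ¬? (j ∈? A))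
  ... | yes i≡j | _ | _ = no λ i↝j → distinct i↝j i≡j
  ... | no _ | yes vj≡0 | _ = no λ i↝j → support i↝j vj≡0
  ... | no _ | no _ | yes (A , tA , i∈A , j∉A) = no λ i↝j → j∉A (forces i↝j A tA i∈A)
  ... | no i≢j | no vj≢0 | no ∄A = yes record
    { distinct = i≢j
    ; support  = vj≢0
    ; forces   = λ A tA i∈A → decidable-stable (j ∈? A) (λ j∉A → ∄A (A , tA , i∈A , j∉A))
    }

  Feasible-e : ∀ {i} → Free i → Feasible (e i)
  Feasible-e {i} free = record
    { tight-nonPos = λ A tA → ≤-reflexive (trans (sumOver-e A i) (∉⇒𝟙≡0 (free A tA)))
    ; zero-nonNeg  = λ k _ → e-nonNeg i k
    }

  Feasible-⊖e : ∀ {j} → v j ≢ 0ℚ → Feasible (⊖ e j)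
  Feasible-⊖e {j} vj≢0 = record
    { tight-nonPos = λ A _ → subst (_≤ 0ℚ) (sym (trans (sumOver-⊖ A (e j)) (cong -_ (sumOver-e A j))))
                               (neg-antimono-≤ (𝟙-nonNeg (lookup A) j))
    ; zero-nonNeg  = λ k vk≡0 → ≤-reflexive (sym (cong -_ (e-off (λ j≡k → vj≢0 (trans (cong v j≡k) vk≡0)))))
    }

  Feasible-shift : ∀ {i j} → i ↝ j → Feasible (e i ⊕ (⊖ e j))
  Feasible-shift {i} {j} i↝j = record
    { tight-nonPos = λ A tA → subst (_≤ 0ℚ) (sym (sumOver-shift A i j))
                               (p≤q⇒p-q≤0 (𝟙-mono (lookup A) i j
                                 (λ i∈A → []=⇒lookup (forces i↝j A tA (lookup⇒[]= i A i∈A)))))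
    ; zero-nonNeg  = λ k vk≡0 → subst (0ℚ ≤_)
        (sym (shift-off-j (λ j≡k → support i↝j (trans (cong v j≡k) vk≡0))))
        (e-nonNeg i k)
    }

  support⇒¬free : ∀ {i} → v i ≢ 0ℚ → ¬ Free i
  support⇒¬free {i} vi≢0 free = 1≢0 (trans (sym (e-diag i)) (Feasible-pointed (Feasible-e free) (Feasible-⊖e vi≢0) i))

  ↝-asym : ∀ {i j} → i ↝ j → ¬ j ↝ i
  ↝-asym {i} {j} i↝j j↝i = 1≢0 (trans (sym (shift-at-i (distinct i↝j)))
    (Feasible-pointed (Feasible-shift i↝j) (Feasible-resp ⊖shift (Feasible-shift j↝i)) i))
    where
    ⊖shift : (e j ⊕ (⊖ e i)) ≐ (⊖ (e i ⊕ (⊖ e j)))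
    ⊖shift k = solve 2 (λ x y → y :+ :- x := :- (x :+ :- y)) refl (e i k) (e j k)

  ↝-trans : ∀ {i j k} → i ↝ j → j ↝ k → i ↝ k
  ↝-trans {i} {j} {k} i↝j j↝k = record
    { distinct = λ i≡k → ↝-asym i↝j (subst (j ↝_) (sym i≡k) j↝k)
    ; support  = support j↝k
    ; forces   = λ A tA i∈A → forces j↝k A tA (forces i↝j A tA i∈A)
    }

  Extreme : Ray n → Set
  Extreme (up i)      = Free i
  Extreme (down j)    = v j ≢ 0ℚ × (∀ p → v p ≢ 0ℚ → ¬ p ↝ j)
  Extreme (shift i j) = i ↝ j × ¬ Free i × (∀ k → ¬ (i ↝ k × k ↝ j))

  extreme? : ∀ d → Dec (Extreme d)
  extreme? (up i)      = free? i
  extreme? (down j)    = ¬? (v j ≟ 0ℚ) ×-dec Fin.all? (λ p → ¬? (v p ≟ 0ℚ) →-dec ¬? (p ↝? j))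
  extreme? (shift i j) = (i ↝? j) ×-dec ¬? (free? i) ×-dec Fin.all? (λ k → ¬? ((i ↝? k) ×-dec (k ↝? j)))

  Extreme⇒Feasible : ∀ d → Extreme d → Feasible (ray d)
  Extreme⇒Feasible (up i) free = Feasible-e free
  Extreme⇒Feasible (down j) (vj≢0 , _) = Feasible-⊖e vj≢0
  Extreme⇒Feasible (shift i j) (i↝j , _) = Feasible-shift i↝j

  extremeRays : List (Ray n)
  extremeRays = filter extreme? (allRays n)

  generators : Fin (length extremeRays) → Vecℚ n
  generators k = ray (List.lookup extremeRays k)

  Hull : Vecℚ n → Set
  Hull = ConicHull generators

  generator-extreme : ∀ k → Extreme (List.lookup extremeRays k)
  generator-extreme k = proj₂ (∈-filter⁻ extreme? {xs = allRays n} (∈-lookup {xs = extremeRays} k))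

  extreme⇒hull : ∀ {d} → Extreme d → Hull (ray d)
  extreme⇒hull {d} ext = resp-≐ (λ i → cong (λ d' → ray d' i) (sym (lookup-index d∈))) (generator (index d∈))
    where
    d∈ : d ∈ₗ extremeRays
    d∈ = ∈-filter⁺ extreme? (∈-allRays d) ext

  Hull⇒Feasible : ∀ {w} → Hull w → Feasible w
  Hull⇒Feasible = ConicHull-closed Feasible Feasible-𝟎 Feasible-⊕ Feasible-⊙ Feasible-resp
                    (λ k → Extreme⇒Feasible _ (generator-extreme k))

  Hull-pointed : ∀ {w} → Hull w → Hull (⊖ w) → w ≐ 𝟎
  Hull-pointed hw h⊖w = Feasible-pointed (Hull⇒Feasible hw) (Hull⇒Feasible h⊖w)

  between : Fin n × Fin n → ℕ
  between (i , j) = count (λ k → (i ↝? k) ×-dec (k ↝? j)) (allFin n)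

  shift∈Hull-¬free : ∀ {i j} → i ↝ j → ¬ Free i → Hull (e i ⊕ (⊖ e j))
  shift∈Hull-¬free {i} {j} = <-rec-on between P step (i , j)
    where
    P : Fin n × Fin n → Set
    P (i , j) = i ↝ j → ¬ Free i → Hull (e i ⊕ (⊖ e j))
    step : ∀ ij → (∀ {kl} → between kl ℕ.< between ij → P kl) → P ij
    step (i , j) ih i↝j ¬free with Fin.any? (λ k → (i ↝? k) ×-dec (k ↝? j))
    ... | no ∄k = extreme⇒hull {shift i j} (i↝j , ¬free , λ k i↝k↝j → ∄k (k , i↝k↝j))
    ... | yes (k , i↝k , k↝j) =
      resp-≐ telescope (add (ih fewer-i-k i↝k ¬free) (ih fewer-k-j k↝j (support⇒¬free (support i↝k))))
      where
      telescope : ((e i ⊕ (⊖ e k)) ⊕ (e k ⊕ (⊖ e j))) ≐ (e i ⊕ (⊖ e j))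
      telescope x = solve 3 (λ a b c → (a :+ :- b) :+ (b :+ :- c) := a :+ :- c) refl (e i x) (e k x) (e j x)
      fewer-i-k : between (i , k) ℕ.< between (i , j)
      fewer-i-k = count-< _ _ (λ m (i↝m , m↝k) → i↝m , ↝-trans m↝k k↝j) (allFin n) (∈-allFin k)
                    (i↝k , k↝j) (λ (_ , k↝k) → distinct k↝k refl)
      fewer-k-j : between (k , j) ℕ.< between (i , j)
      fewer-k-j = count-< _ _ (λ m (k↝m , m↝j) → ↝-trans i↝k k↝m , m↝j) (allFin n) (∈-allFin k)
                    (i↝k , k↝j) (λ (k↝k , _) → distinct k↝k refl)

  predecessors : Fin n → ℕ
  predecessors j = count (_↝? j) (allFin n)

  ⊖e∈Hull : ∀ {j} → v j ≢ 0ℚ → Hull (⊖ e j)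
  ⊖e∈Hull {j} = <-rec-on predecessors (λ j → v j ≢ 0ℚ → Hull (⊖ e j)) step j
    where
    step : ∀ j → (∀ {p} → predecessors p ℕ.< predecessors j → v p ≢ 0ℚ → Hull (⊖ e p)) → v j ≢ 0ℚ → Hull (⊖ e j)
    step j ih vj≢0 with Fin.any? (λ p → ¬? (v p ≟ 0ℚ) ×-dec (p ↝? j))
    ... | no ∄p = extreme⇒hull {down j} (vj≢0 , λ p vp≢0 p↝j → ∄p (p , vp≢0 , p↝j))
    ... | yes (p , vp≢0 , p↝j) =
      resp-≐ telescope (add (shift∈Hull-¬free p↝j (support⇒¬free vp≢0)) (ih fewer vp≢0))
      where
      telescope : ((e p ⊕ (⊖ e j)) ⊕ (⊖ e p)) ≐ (⊖ e j)
      telescope x = solve 2 (λ a b → (a :+ :- b) :+ :- a := :- b) refl (e p x) (e j x)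
      fewer : predecessors p ℕ.< predecessors j
      fewer = count-< _ _ (λ q q↝p → ↝-trans q↝p p↝j) (allFin n) (∈-allFin p) p↝j (λ p↝p → distinct p↝p refl)

  shift∈Hull : ∀ {i j} → i ↝ j → Hull (e i ⊕ (⊖ e j))
  shift∈Hull {i} i↝j with free? i
  ... | yes free = add (extreme⇒hull {up i} free) (⊖e∈Hull (support i↝j))
  ... | no ¬free = shift∈Hull-¬free i↝j ¬free

  nonPos∈Hull : ∀ {w} → Feasible w → (∀ i → w i ≤ 0ℚ) → Hull w
  nonPos∈Hull {w} fw w≤0 = resp-≐ w≐ (ConicHull-bind entry∈Hull (conicComb∈ConicHull entries (λ _ → 1ℚ) (λ _ → 0≤1)))
    where
    entries : Fin n → Vecℚ n
    entries j = w j ⊙ e j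
    entry∈Hull : ∀ j → Hull (entries j)
    entry∈Hull j with w j ≟ 0ℚ
    ... | yes wj≡0 = resp-≐ (λ k → trans (sym (*-zeroˡ (e j k))) (cong (_* e j k) (sym wj≡0))) origin
    ... | no wj≢0 = resp-≐ (λ k → solve 2 (λ x y → :- x :* (:- y) := x :* y) refl (w j) (e j k))
                      (scale (neg-antimono-≤ (w≤0 j)) (⊖e∈Hull vj≢0))
      where
      vj≢0 : v j ≢ 0ℚ
      vj≢0 vj≡0 = wj≢0 (≤-antisym (w≤0 j) (zero-nonNeg fw j vj≡0))
    w≐ : conicComb (λ _ → 1ℚ) entries ≐ w
    w≐ i = trans (sumFin-single _ i (λ j j≢i → trans (cong (λ x → 1ℚ * (w j * x)) (e-off j≢i))
                                                       (solve 1 (λ x → con 1ℚ :* (x :* con 0ℚ) := con 0ℚ) refl (w j))))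
                 (trans (cong (λ x → 1ℚ * (w i * x)) (e-diag i)) (solve 1 (λ x → con 1ℚ :* (x :* con 1ℚ) := x) refl (w i)))

  measure : Vecℚ n → ℕ
  measure w = count (λ i → ¬? (w i ≟ 0ℚ)) (allFin n) ℕ.+ count (λ A → tight? A ×-dec ¬? (sumOver A w ≟ 0ℚ)) (allSubsets n)

  record _≺_ (w' w : Vecℚ n) : Set where
    field
      entries    : ∀ k → w' k ≢ 0ℚ → w k ≢ 0ℚ
      tight-sums : ∀ A → Tight A → sumOver A w' ≢ 0ℚ → sumOver A w ≢ 0ℚ
      vanishing  : (Σ (Fin n) λ k → w k ≢ 0ℚ × w' k ≡ 0ℚ)
                 ⊎ (Σ (Subset n) λ A → Tight A × sumOver A w ≢ 0ℚ × sumOver A w' ≡ 0ℚ)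

  ≺⇒measure< : ∀ {w' w} → w' ≺ w → measure w' ℕ.< measure w
  ≺⇒measure< {w'} {w} w'≺w with _≺_.vanishing w'≺w
  ... | inj₁ (k , wk≢0 , w'k≡0) = ℕ.+-mono-<-≤
          (count-< _ _ (_≺_.entries w'≺w) (allFin n) (∈-allFin k) wk≢0 (λ w'k≢0 → w'k≢0 w'k≡0))
          (count-mono _ _ (λ A (tA , ≢0) → tA , _≺_.tight-sums w'≺w A tA ≢0) (allSubsets n))
  ... | inj₂ (A , tA , ≢0 , ≡0) = ℕ.+-mono-≤-<
          (count-mono _ _ (_≺_.entries w'≺w) (allFin n))
          (count-< _ _ (λ B (tB , ≢0) → tB , _≺_.tight-sums w'≺w B tB ≢0) (allSubsets n) (∈-allSubsets A)
                   (tA , ≢0) (λ (_ , ≢0') → ≢0' ≡0))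

  record Peeling (w : Vecℚ n) : Set where
    field
      amount         : ℚ
      direction      : Vecℚ n
      amount-nonNeg  : 0ℚ ≤ amount
      direction∈Hull : Hull direction
      rest-feasible  : Feasible (peel amount direction w)
      rest≺w         : peel amount direction w ≺ w

  peel-free : ∀ {w i} → Feasible w → Free i → 0ℚ < w i → Peeling w
  peel-free {w} {i} fw free 0<wi = record
    { amount         = w i
    ; direction      = e i
    ; amount-nonNeg  = <⇒≤ 0<wi
    ; direction∈Hull = extreme⇒hull {up i} free
    ; rest-feasible  = record
      { tight-nonPos = λ A tA → subst (_≤ 0ℚ) (sym (w'-tight A tA)) (tight-nonPos fw A tA)
      ; zero-nonNeg  = w'-zero-nonNeg
      }
    ; rest≺w         = record
      { entries    = w'-entries
      ; tight-sums = λ A tA w'A≢0 wA≡0 → w'A≢0 (trans (w'-tight A tA) wA≡0)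
      ; vanishing  = inj₁ (i , <⇒≢ 0<wi ∘ sym , w'-at)
      }
    }
    where
    w' : Vecℚ n
    w' = peel (w i) (e i) w
    w'-at : w' i ≡ 0ℚ
    w'-at = trans (peel-e-at (w i) i w) (+-inverseʳ (w i))
    w'-off : ∀ {k} → i ≢ k → w' k ≡ w k
    w'-off i≢k = peel-off (w i) (e i) w (e-off i≢k)
    w'-tight : ∀ A → Tight A → sumOver A w' ≡ sumOver A w
    w'-tight A tA = trans (sumOver-peel A (w i) (e i) w)
      (trans (cong (λ x → sumOver A w - w i * x) (trans (sumOver-e A i) (∉⇒𝟙≡0 (free A tA))))
             (solve 2 (λ s t → s :- t :* con 0ℚ := s) refl (sumOver A w) (w i)))
    w'-zero-nonNeg : ∀ k → v k ≡ 0ℚ → 0ℚ ≤ w' k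
    w'-zero-nonNeg k vk≡0 = by-cases (i Fin.≟ k)
      where
      by-cases : Dec (i ≡ k) → 0ℚ ≤ w' k
      by-cases (yes refl) = ≤-reflexive (sym w'-at)
      by-cases (no i≢k) = subst (0ℚ ≤_) (sym (w'-off i≢k)) (zero-nonNeg fw k vk≡0)
    w'-entries : ∀ k → w' k ≢ 0ℚ → w k ≢ 0ℚ
    w'-entries k w'k≢0 = by-cases (i Fin.≟ k)
      where
      by-cases : Dec (i ≡ k) → w k ≢ 0ℚ
      by-cases (yes refl) = <⇒≢ 0<wi ∘ sym
      by-cases (no i≢k) = w'k≢0 ∘ trans (w'-off i≢k)

  module ShiftPeeling {w : Vecℚ n} (fw : Feasible w) {i : Fin n} (¬free : ¬ Free i) (0<wi : 0ℚ < w i) where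

    Through-i : Subset n → Set
    Through-i A = Tight A × i ∈ A

    through-i? : ∀ A → Dec (Through-i A)
    through-i? A = tight? A ×-dec i ∈? A

    closure : Subset n
    closure = ⋂ (proj₁ (¬free⇒tight-set ¬free) ∷ filter through-i? (allSubsets n))

    closure-through-i : Through-i closure
    closure-through-i = ⋂-closed (λ (tA , i∈A) (tB , i∈B) → proj₂ (tight-∪-∩ tA tB) , x∈p∩q⁺ (i∈A , i∈B))
                          (proj₂ (¬free⇒tight-set ¬free) ∷ all-filter through-i? (allSubsets n))

    closure-⊆ : ∀ A → Tight A → i ∈ A → closure ⊆ A
    closure-⊆ A tA i∈A = ⋂-⊆ (there (∈-filter⁺ through-i? (∈-allSubsets A) (tA , i∈A)))

    Balanced : Subset n → Set
    Balanced A = Tight A × sumOver A w ≡ 0ℚ × i ∉ A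

    balanced? : ∀ A → Dec (Balanced A)
    balanced? A = tight? A ×-dec (sumOver A w ≟ 0ℚ) ×-dec ¬? (i ∈? A)

    balanced-∪ : ∀ {A B} → Balanced A → Balanced B → Balanced (A ∪ B)
    balanced-∪ {A} {B} (tA , wA≡0 , i∉A) (tB , wB≡0 , i∉B) =
      t∪ , proj₁ (+-squeeze (tight-nonPos fw _ t∪) (tight-nonPos fw _ t∩) (≤-reflexive sum≡0)) ,
      [ i∉A , i∉B ]′ ∘ x∈p∪q⁻ A B
      where
      t∪ : Tight (A ∪ B)
      t∪ = proj₁ (tight-∪-∩ tA tB)
      t∩ : Tight (A ∩ B)
      t∩ = proj₂ (tight-∪-∩ tA tB)
      sum≡0 : 0ℚ + 0ℚ ≡ sumOver (A ∪ B) w + sumOver (A ∩ B) w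
      sum≡0 = sym (trans (sumOver-∪-∩ A B w) (cong₂ _+_ wA≡0 wB≡0))

    core : Subset n
    core = ⋃ (filter balanced? (allSubsets n))

    core-balanced : Balanced core
    core-balanced = ⋃-closed (tight-⊥ , sumOver-⊥ w , ∉⊥) balanced-∪ (all-filter balanced? (allSubsets n))

    ⊆-core : ∀ {A} → Balanced A → A ⊆ core
    ⊆-core {A} bA = ⊆-⋃ (∈-filter⁺ balanced? (∈-allSubsets A) bA)

    Partner : Fin n → Set
    Partner j = j ∈ closure × j ∉ core × w j < 0ℚ

    -- Otherwise w sums to at least w i > 0 over the tight set closure ∪ core.
    partner : Σ (Fin n) Partner
    partner = search (Fin.any? (λ j → j ∈? closure ×-dec ¬? (j ∈? core) ×-dec (w j <? 0ℚ)))
      where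
      search : Dec (Σ (Fin n) Partner) → Σ (Fin n) Partner
      search (yes found) = found
      search (no ∄j) = contradiction (tight-nonPos fw _ (proj₁ (tight-∪-∩ (proj₁ closure-through-i) (proj₁ core-balanced))))
                         (<⇒≱ (sumOver-∪-positive closure core w i 0<wi (proj₂ closure-through-i)
                                 (proj₂ (proj₂ core-balanced)) (proj₁ (proj₂ core-balanced))
                                 (λ k k∈c k∉core → ≮⇒≥ (λ wk<0 → ∄j (k , k∈c , k∉core , wk<0)))))

    module Toward {j : Fin n} (j∈closure : j ∈ closure) (j∉core : j ∉ core) (wj<0 : w j < 0ℚ) where

      i↝j : i ↝ j
      i↝j = record
        { distinct = λ i≡j → <-asym 0<wi (subst (λ k → w k < 0ℚ) (sym i≡j) wj<0)
        ; support  = λ vj≡0 → <⇒≱ wj<0 (zero-nonNeg fw j vj≡0)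
        ; forces   = λ A tA i∈A → closure-⊆ A tA i∈A j∈closure
        }

      Blocking : Subset n → Set
      Blocking B = Tight B × j ∈ B × i ∉ B

      blocking? : ∀ B → Dec (Blocking B)
      blocking? B = tight? B ×-dec j ∈? B ×-dec ¬? (i ∈? B)

      blocking-negative : ∀ {B} → Blocking B → sumOver B w < 0ℚ
      blocking-negative {B} (tB , j∈B , i∉B) =
        ≤∧≢⇒< (tight-nonPos fw B tB) (λ wB≡0 → j∉core (⊆-core (tB , wB≡0 , i∉B) j∈B))

      blockers : List (Subset n)
      blockers = filter blocking? (allSubsets n)

      -- The largest step along e i − e j that keeps w feasible: it empties entry i or the sum
      -- over some blocking set.
      candidates : List ℚ
      candidates = map (λ B → - sumOver B w) blockers

      step : ℚ
      step = Extrema.min (w i) candidates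

      0<step : 0ℚ < step
      0<step = Extrema.argmin-all id {P = 0ℚ <_} 0<wi
        (All.map⁺ (All.map (neg-antimono-< ∘ blocking-negative) (all-filter blocking? (allSubsets n))))

      step≤wi : step ≤ w i
      step≤wi = Extrema.min≤⊤ (w i) candidates

      step≤-wB : ∀ {B} → Blocking B → step ≤ - sumOver B w
      step≤-wB {B} bB = All.lookup (All.map⁻ (Extrema.min≤xs (w i) candidates))
                          (∈-filter⁺ blocking? (∈-allSubsets B) bB)

      step-attained : step ≡ w i ⊎ Σ (Subset n) λ B → Blocking B × step ≡ - sumOver B w
      step-attained = attained (Extrema.argmin-sel id (w i) candidates)
        where
        attained : step ≡ w i ⊎ step ∈ₗ candidates → step ≡ w i ⊎ Σ (Subset n) λ B → Blocking B × step ≡ - sumOver B w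
        attained (inj₁ ≡wi) = inj₁ ≡wi
        attained (inj₂ ∈candidates) =
          let (B , B∈ , ≡-wB) = ∈-map⁻ (λ B → - sumOver B w) ∈candidates
          in inj₂ (B , proj₂ (∈-filter⁻ blocking? {xs = allSubsets n} B∈) , ≡-wB)

      i≢j : i ≢ j
      i≢j = distinct i↝j

      w' : Vecℚ n
      w' = peel step (e i ⊕ (⊖ e j)) w

      w'-i : w' i ≡ w i - step
      w'-i = trans (cong (λ x → w i + (- step) * x) (shift-at-i i≢j)) (cong (w i +_) (*-identityʳ (- step)))

      w'-off : ∀ {k} → i ≢ k → j ≢ k → w' k ≡ w k
      w'-off i≢k j≢k = peel-off step (e i ⊕ (⊖ e j)) w (shift-off i≢k j≢k)

      w'-sum : ∀ A → sumOver A w' ≡ sumOver A w - step * (𝟙 (lookup A) i - 𝟙 (lookup A) j)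
      w'-sum A = trans (sumOver-peel A step (e i ⊕ (⊖ e j)) w) (cong (λ x → sumOver A w - step * x) (sumOver-shift A i j))

      w'-unblocked : ∀ {A} → Tight A → ¬ Blocking A → sumOver A w' ≡ sumOver A w
      w'-unblocked {A} tA unblocked = trans (w'-sum A) (by-cases (i ∈? A))
        where
        unchanged : ∀ x → sumOver A w - step * (x - x) ≡ sumOver A w
        unchanged x = solve 3 (λ s t x → s :- t :* (x :- x) := s) refl (sumOver A w) step x
        by-cases : Dec (i ∈ A) → sumOver A w - step * (𝟙 (lookup A) i - 𝟙 (lookup A) j) ≡ sumOver A w
        by-cases (yes i∈A) = trans (cong₂ (λ x y → sumOver A w - step * (x - y)) (∈⇒𝟙≡1 i∈A) (∈⇒𝟙≡1 (forces i↝j A tA i∈A)))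
                                   (unchanged 1ℚ)
        by-cases (no i∉A) = trans (cong₂ (λ x y → sumOver A w - step * (x - y))
                                         (∉⇒𝟙≡0 i∉A) (∉⇒𝟙≡0 λ j∈A → unblocked (tA , j∈A , i∉A)))
                                  (unchanged 0ℚ)

      w'-blocked : ∀ {A} → Blocking A → sumOver A w' ≡ sumOver A w + step
      w'-blocked {A} (_ , j∈A , i∉A) = trans (w'-sum A)
        (trans (cong₂ (λ x y → sumOver A w - step * (x - y)) (∉⇒𝟙≡0 i∉A) (∈⇒𝟙≡1 j∈A))
               (solve 2 (λ s t → s :- t :* (con 0ℚ :- con 1ℚ) := s :+ t) refl (sumOver A w) step))

      w'-tight-nonPos : ∀ A → Tight A → sumOver A w' ≤ 0ℚ
      w'-tight-nonPos A tA = by-cases (blocking? A)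
        where
        by-cases : Dec (Blocking A) → sumOver A w' ≤ 0ℚ
        by-cases (yes bA) = subst (_≤ 0ℚ) (sym (w'-blocked bA))
          (subst (sumOver A w + step ≤_) (+-inverseʳ (sumOver A w)) (+-monoʳ-≤ (sumOver A w) (step≤-wB bA)))
        by-cases (no ¬bA) = subst (_≤ 0ℚ) (sym (w'-unblocked tA ¬bA)) (tight-nonPos fw A tA)

      w'-zero-nonNeg : ∀ k → v k ≡ 0ℚ → 0ℚ ≤ w' k
      w'-zero-nonNeg k vk≡0 = by-cases (i Fin.≟ k)
        where
        by-cases : Dec (i ≡ k) → 0ℚ ≤ w' k
        by-cases (yes refl) = subst (0ℚ ≤_) (sym w'-i) (p≤q⇒0≤q-p step≤wi)
        by-cases (no i≢k) = subst (0ℚ ≤_) (sym (w'-off i≢k (λ j≡k → support i↝j (trans (cong v j≡k) vk≡0))))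
                              (zero-nonNeg fw k vk≡0)

      w'-entries : ∀ k → w' k ≢ 0ℚ → w k ≢ 0ℚ
      w'-entries k w'k≢0 = by-cases (i Fin.≟ k) (j Fin.≟ k)
        where
        by-cases : Dec (i ≡ k) → Dec (j ≡ k) → w k ≢ 0ℚ
        by-cases (yes refl) _ = <⇒≢ 0<wi ∘ sym
        by-cases (no _) (yes refl) = <⇒≢ wj<0
        by-cases (no i≢k) (no j≢k) = w'k≢0 ∘ trans (w'-off i≢k j≢k)

      w'-tight-sums : ∀ A → Tight A → sumOver A w' ≢ 0ℚ → sumOver A w ≢ 0ℚ
      w'-tight-sums A tA w'A≢0 = by-cases (blocking? A)
        where
        by-cases : Dec (Blocking A) → sumOver A w ≢ 0ℚ
        by-cases (yes bA) = <⇒≢ (blocking-negative bA)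
        by-cases (no ¬bA) = w'A≢0 ∘ trans (w'-unblocked tA ¬bA)

      Vanishing : Set
      Vanishing = (Σ (Fin n) λ k → w k ≢ 0ℚ × w' k ≡ 0ℚ)
                ⊎ (Σ (Subset n) λ A → Tight A × sumOver A w ≢ 0ℚ × sumOver A w' ≡ 0ℚ)

      w'-vanishing : Vanishing
      w'-vanishing = by-cases step-attained
        where
        by-cases : step ≡ w i ⊎ Σ (Subset n) (λ B → Blocking B × step ≡ - sumOver B w) → Vanishing
        by-cases (inj₁ ≡wi) = inj₁ (i , <⇒≢ 0<wi ∘ sym , trans w'-i (trans (cong (λ t → w i - t) ≡wi) (+-inverseʳ (w i))))
        by-cases (inj₂ (B , bB , ≡-wB)) = inj₂ (B , proj₁ bB , <⇒≢ (blocking-negative bB) ,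
          trans (w'-blocked bB) (trans (cong (sumOver B w +_) ≡-wB) (+-inverseʳ (sumOver B w))))

      peeling : Peeling w
      peeling = record
        { amount         = step
        ; direction      = e i ⊕ (⊖ e j)
        ; amount-nonNeg  = <⇒≤ 0<step
        ; direction∈Hull = shift∈Hull i↝j
        ; rest-feasible  = record { tight-nonPos = w'-tight-nonPos ; zero-nonNeg = w'-zero-nonNeg }
        ; rest≺w         = record { entries = w'-entries ; tight-sums = w'-tight-sums ; vanishing = w'-vanishing }
        }

    peeling : Peeling w
    peeling = let (_ , j∈closure , j∉core , wj<0) = partner in Toward.peeling j∈closure j∉core wj<0

  peeling : ∀ {w i} → Feasible w → 0ℚ < w i → Peeling w
  peeling {w} {i} fw 0<wi = by-cases (free? i)
    where
    by-cases : Dec (Free i) → Peeling w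
    by-cases (yes free) = peel-free fw free 0<wi
    by-cases (no ¬free) = ShiftPeeling.peeling fw ¬free 0<wi

  feasible⇒hull : ∀ {w} → Feasible w → Hull w
  feasible⇒hull {w} = <-rec-on measure (λ w → Feasible w → Hull w) peel-once w
    where
    peel-once : ∀ w → (∀ {w'} → measure w' ℕ.< measure w → Feasible w' → Hull w') → Feasible w → Hull w
    peel-once w ih fw = by-cases (Fin.any? (λ i → 0ℚ <? w i))
      where
      by-cases : Dec (Σ (Fin n) λ i → 0ℚ < w i) → Hull w
      by-cases (no ∄pos) = nonPos∈Hull fw (λ i → ≮⇒≥ (λ 0<wi → ∄pos (i , 0<wi)))
      by-cases (yes (i , 0<wi)) = resp-≐ (peel-restore amount direction w)
        (add (ih (≺⇒measure< rest≺w) rest-feasible) (scale amount-nonNeg direction∈Hull))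
        where open Peeling (peeling fw 0<wi)

  BelowOrAt : Fin n → Fin n → Set
  BelowOrAt j x = x ≡ j ⊎ x ↝ j

  belowOrAt? : ∀ j x → Dec (BelowOrAt j x)
  belowOrAt? j x = (x Fin.≟ j) ⊎-dec (x ↝? j)

  Between : Fin n → Fin n → Fin n → Set
  Between i j x = x ≡ i ⊎ (i ↝ x × x ≢ j)

  between? : ∀ i j x → Dec (Between i j x)
  between? i j x = (x Fin.≟ i) ⊎-dec ((i ↝? x) ×-dec ¬? (x Fin.≟ j))

  separator : Ray n → Vecℚ n
  separator (up i)      = e i
  separator (down j)    = ⊖ 𝟙? (belowOrAt? j)
  separator (shift i j) = 𝟙? (between? i j)

  separator-positive : ∀ d → Extreme d → 0ℚ < separator d · ray d
  separator-positive d ext = subst (0ℚ <_) (sym (·-ray (separator d) d)) (on-ray d ext)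
    where
    on-ray : ∀ d → Extreme d → 0ℚ < evaluate (separator d) d
    on-ray (up i) _ = subst (0ℚ <_) (sym (e-diag i)) (positive⁻¹ 1ℚ)
    on-ray (down j) _ = subst (0ℚ <_) (sym (trans (neg-involutive _) (𝟙?-yes (belowOrAt? j) (inj₁ refl)))) (positive⁻¹ 1ℚ)
    on-ray (shift i j) (i↝j , _) = subst (0ℚ <_)
      (sym (trans (cong₂ _-_ (𝟙?-yes (between? i j) (inj₁ refl))
                            (𝟙?-no (between? i j) [ distinct i↝j ∘ sym , (λ (_ , j≢j) → j≢j refl) ]′))
                  (+-identityʳ 1ℚ)))
      (positive⁻¹ 1ℚ)

  separates : ∀ d d' → Extreme d → Extreme d' → separator d · ray d' ≤ 0ℚ ⊎ d' ≡ d
  separates d d' ext ext' = Sum.map₁ (subst (_≤ 0ℚ) (sym (·-ray (separator d) d'))) (off-ray d d' ext ext')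
    where
    off-ray : ∀ d d' → Extreme d → Extreme d' → evaluate (separator d) d' ≤ 0ℚ ⊎ d' ≡ d
    off-ray (up i) (up k) _ _ with k Fin.≟ i
    ... | yes refl = inj₂ refl
    ... | no k≢i = inj₁ (≤-reflexive (e-off (k≢i ∘ sym)))
    off-ray (up i) (down q) _ _ = inj₁ (neg-antimono-≤ (e-nonNeg i q))
    off-ray (up i) (shift a b) free (_ , ¬free-a , _) = inj₁ (begin
      e i a - e i b ≡⟨ cong (_- e i b) (e-off (λ i≡a → ¬free-a (subst Free i≡a free))) ⟩
      0ℚ - e i b    ≡⟨ +-identityˡ (- e i b) ⟩
      - e i b       ≤⟨ neg-antimono-≤ (e-nonNeg i b) ⟩
      0ℚ            ∎)
      where open ≤-Reasoning
    off-ray (down j) (up k) _ _ = inj₁ (neg-antimono-≤ (𝟙?-nonNeg (belowOrAt? j) k))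
    off-ray (down j) (down q) (_ , minimal) (vq≢0 , _) = by-cases (q Fin.≟ j)
      where
      by-cases : Dec (q ≡ j) → - - 𝟙? (belowOrAt? j) q ≤ 0ℚ ⊎ down q ≡ down j
      by-cases (yes refl) = inj₂ refl
      by-cases (no q≢j) = inj₁ (≤-reflexive (trans (neg-involutive _) (𝟙?-no (belowOrAt? j) [ q≢j , minimal q vq≢0 ]′)))
    off-ray (down j) (shift a b) _ (a↝b , _) = inj₁ (subst (_≤ 0ℚ)
      (solve 2 (λ x y → y :- x := :- x :- :- y) refl (𝟙? (belowOrAt? j) a) (𝟙? (belowOrAt? j) b))
      (p≤q⇒p-q≤0 (𝟙?-mono (belowOrAt? j) backward)))
      where
      backward : BelowOrAt j b → BelowOrAt j a
      backward (inj₁ b≡j) = inj₂ (subst (a ↝_) b≡j a↝b)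
      backward (inj₂ b↝j) = inj₂ (↝-trans a↝b b↝j)
    off-ray (shift i j) (up k) (_ , ¬free-i , _) free-k = inj₁ (≤-reflexive (𝟙?-no (between? i j)
      [ (λ k≡i → ¬free-i (subst Free k≡i free-k)) , (λ (i↝k , _) → free-k A tA (forces i↝k A tA i∈A)) ]′))
      where
      A : Subset n
      A = proj₁ (¬free⇒tight-set ¬free-i)
      tA : Tight A
      tA = proj₁ (proj₂ (¬free⇒tight-set ¬free-i))
      i∈A : i ∈ A
      i∈A = proj₂ (proj₂ (¬free⇒tight-set ¬free-i))
    off-ray (shift i j) (down q) _ _ = inj₁ (neg-antimono-≤ (𝟙?-nonNeg (between? i j) q))
    off-ray (shift i j) (shift a b) (_ , _ , nothing-between) (a↝b , _) = by-cases (a Fin.≟ i) (b Fin.≟ j)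
      where
      forward : (a ≡ i → b ≢ j) → Between i j a → Between i j b
      forward a≡i⇒b≢j (inj₁ a≡i) = inj₂ (subst (_↝ b) a≡i a↝b , a≡i⇒b≢j a≡i)
      forward _ (inj₂ (i↝a , _)) = inj₂ (↝-trans i↝a a↝b , λ b≡j → nothing-between a (i↝a , subst (a ↝_) b≡j a↝b))
      by-cases : Dec (a ≡ i) → Dec (b ≡ j) → 𝟙? (between? i j) a - 𝟙? (between? i j) b ≤ 0ℚ ⊎ shift a b ≡ shift i j
      by-cases (yes refl) (yes refl) = inj₂ refl
      by-cases (yes refl) (no b≢j) = inj₁ (p≤q⇒p-q≤0 (𝟙?-mono (between? i j) (forward (λ _ → b≢j))))
      by-cases (no a≢i) _ = inj₁ (p≤q⇒p-q≤0 (𝟙?-mono (between? i j) (forward (λ a≡i → contradiction a≡i a≢i))))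

  generator-extremal : ∀ k → IsExtremalRayGenerator Hull (generators k)
  generator-extremal k = Separation.separated⇒extremal generators (separator d) separated Hull-pointed
                           (generator k) (separator-positive d (generator-extreme k))
    where
    d : Ray n
    d = List.lookup extremeRays k
    separated : ∀ h → separator d · generators h ≤ 0ℚ ⊎ generators h ≐ generators k
    separated h = Sum.map₂ (λ d'≡d x → cong (λ d → ray d x) d'≡d)
                    (separates d (List.lookup extremeRays h) (generator-extreme k) (generator-extreme h))

  ∈supp : ∀ {j} → v j ≢ 0ℚ → j ∈ supp v
  ∈supp {j} vj≢0 = lookup⇒[]= j (supp v) (trans (lookup∘tabulate _ j) (cong not (isYes-false (v j ≟ 0ℚ) vj≢0)))

  extreme⇒InR : ∀ d → Extreme d → InR (supp v) (ray d)
  extreme⇒InR (up i) _ = inj₂ (inj₁ (i , λ _ → refl))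
  extreme⇒InR (down j) (vj≢0 , _) = inj₂ (inj₂ (j , ∈supp vj≢0 , λ _ → refl))
  extreme⇒InR (shift i j) (i↝j , _) = inj₁ (i , j , ∈supp (support i↝j) , λ _ → refl)

mainTheorem7 : (n : ℕ) (ψ : Subset n → ℤ) → IsIntegralPolymatroid ψ →
    (v : Vecℚ n) → IsVertex (Polymatroid ψ) v →
    Σ ℕ λ l → Σ (Fin l → Vecℚ n) λ r →
      GeneratedBy (TangentCone (Polymatroid ψ) v) r
      × (∀ k → IsExtremalRayGenerator (TangentCone (Polymatroid ψ) v) (r k))
      × (∀ k → InR (supp v) (r k))
mainTheorem7 n ψ hψ v hv =
  length extremeRays , generators ,
  generatedBy-ConicHull (TangentCone (Polymatroid ψ) v) generators tangent⇒hull hull⇒tangent ,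
  (λ k → IsExtremalRayGenerator-resp hull⇒tangent tangent⇒hull (generator-extremal k)) ,
  (λ k → extreme⇒InR _ (generator-extreme k))
  where
  open AtVertex hψ hv
  tangent⇒hull : ∀ {w} → TangentCone (Polymatroid ψ) v w → Hull w
  tangent⇒hull = feasible⇒hull ∘ tangent⇒feasible
  hull⇒tangent : ∀ {w} → Hull w → TangentCone (Polymatroid ψ) v w
  hull⇒tangent = feasible⇒tangent ∘ Hull⇒Feasible
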